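{- Let $d\ge1$ and $n\equiv1\bmod d$. The poset $\mathrm{NC}^d_n$ is graded of rank $(n-1)/d$, and its rank function is $\rho(\pi)=(n-|\pi|)/d$, where $|\pi|$ is the number of blocks of $\pi$.
   Context: A partition of $[n]$ is noncrossing if there are no $i<j<k<\ell$ with $i,k$ in one block and $j,\ell$ in a different block. The Kreweras dual $\pi'$ of a noncrossing partition $\pi$ of $[n]$: place $1,1',2,2',\dots,n,n'$ on a circle in this cyclic order; $\pi'$ is the coarsest partition of $\{1',\dots,n'\}$ such that the blocks of $\pi$ and of $\pi'$ together form a noncrossing partition of these $2n$ points. $\mathrm{NC}^d_n$ is the poset, ordered by refinement, of noncrossing partitions $\pi$ of $[n]$ such that every block of $\pi$ and of $\pi'$ has cardinality congruent to $1$ modulo $d$. -}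

module Defs where

open import Data.Nat using (ℕ; zero; suc; _+_; _*_; _<_; _<ᵇ_; _∸_; NonZero)
open import Data.Nat.DivMod using (_%_; _/_)
open import Data.Fin using (Fin; toℕ)
open import Data.Bool using (Bool; true; false; T; _∧_; not; if_then_else_)
open import Data.List using (List; map; allFin)
open import Data.Nat.ListAction using (sum)
open import Data.Bool.ListAction using (any)
open import Data.Sum using (_⊎_; inj₁; inj₂)
open import Data.Product using (Σ; _×_; ∃; proj₁)
open import Relation.Nullary using (¬_)
open import Relation.Binary.PropositionalEquality using (_≡_)

record Partition (n : ℕ) : Set where
  field
    rel    : Fin n → Fin n → Bool
    rel-refl  : ∀ i → T (rel i i)
    rel-sym   : ∀ i j → T (rel i j) → T (rel j i)
    rel-trans : ∀ i j k → T (rel i j) → T (rel j k) → T (rel i k)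
open Partition public

_≤P_ : ∀ {n} → Partition n → Partition n → Set
π ≤P σ = ∀ i j → T (rel π i j) → T (rel σ i j)

-- Noncrossing condition for a Boolean "same block" relation on points
-- placed on a line (equivalently a circle) at positions pos:
-- no a < b < c < e with a,c in one block and b,e in a different block.
NoncrossingOn : {X : Set} → (X → ℕ) → (X → X → Bool) → Set
NoncrossingOn pos R = ∀ a b c e → pos a < pos b → pos b < pos c → pos c < pos e
  → T (R a c) → T (R b e) → T (R a b)

Noncrossing : ∀ {n} → Partition n → Set
Noncrossing π = NoncrossingOn toℕ (rel π)

-- The 2n points 1,1',2,2',...,n,n' : inj₁ i is the point i, inj₂ i is i'.
pos2 : ∀ {n} → Fin n ⊎ Fin n → ℕ
pos2 (inj₁ i) = 2 * toℕ i
pos2 (inj₂ i) = suc (2 * toℕ i)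

joinRel : ∀ {n} → Partition n → Partition n → Fin n ⊎ Fin n → Fin n ⊎ Fin n → Bool
joinRel π σ (inj₁ i) (inj₁ j) = rel π i j
joinRel π σ (inj₂ i) (inj₂ j) = rel σ i j
joinRel π σ (inj₁ i) (inj₂ j) = false
joinRel π σ (inj₂ i) (inj₁ j) = false

IsKrewerasDual : ∀ {n} → Partition n → Partition n → Set
IsKrewerasDual {n} π σ =
  NoncrossingOn pos2 (joinRel π σ) ×
  (∀ (τ : Partition n) → NoncrossingOn pos2 (joinRel π τ) → τ ≤P σ)

blockSize : ∀ {n} → Partition n → Fin n → ℕ
blockSize {n} π i = sum (map (λ j → if rel π i j then 1 else 0) (allFin n))

-- number of blocks = number of elements that are the least element of their block
numBlocks : ∀ {n} → Partition n → ℕ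
numBlocks {n} π =
  sum (map (λ i → if any (λ j → (toℕ j <ᵇ toℕ i) ∧ rel π j i) (allFin n) then 0 else 1)
           (allFin n))

BlocksOneMod : ∀ {n} (d : ℕ) .{{_ : NonZero d}} → Partition n → Set
BlocksOneMod d π = ∀ i → blockSize π i % d ≡ 1 % d

InNC : ∀ (d n : ℕ) .{{_ : NonZero d}} → Partition n → Set
InNC d n π = Noncrossing π ×
  Σ (Partition n) (λ σ → IsKrewerasDual π σ × BlocksOneMod d π × BlocksOneMod d σ)

NC : ∀ (d n : ℕ) .{{_ : NonZero d}} → Set
NC d n = Σ (Partition n) (InNC d n)

module PosetNotions {P : Set} (_≤_ : P → P → Set) where

  _≺_ : P → P → Set
  x ≺ y = (x ≤ y) × ¬ (y ≤ x)

  _⋖_ : P → P → Set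
  x ⋖ y = (x ≺ y) × (∀ z → x ≺ z → ¬ (z ≺ y))

  Minimal : P → Set
  Minimal x = ∀ z → ¬ (z ≺ x)

  Maximal : P → Set
  Maximal x = ∀ z → ¬ (x ≺ z)

  data SatChain : P → P → ℕ → Set where
    done : ∀ {x} → SatChain x x 0
    step : ∀ {x y z k} → x ⋖ y → SatChain y z k → SatChain x z (suc k)

  -- A maximal chain (of a finite poset) is a saturated chain from a minimal
  -- to a maximal element.  Graded of rank r: every maximal chain has length r.
  GradedOfRank : ℕ → Set
  GradedOfRank r = ∀ x y k → Minimal x → Maximal y → SatChain x y k → k ≡ r

  -- ρ is the rank function: ρ(y) is the length of every maximal chain of {z ≤ y},
  -- i.e. of every saturated chain from a minimal element to y.
  HasRankFunction : (P → ℕ) → Set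
  HasRankFunction ρ = ∀ x y k → Minimal x → SatChain x y k → k ≡ ρ y

_≤NC_ : ∀ {d n} .{{_ : NonZero d}} → NC d n → NC d n → Set
x ≤NC y = proj₁ x ≤P proj₁ y

module Submission where

open import Defs
open import Data.Nat using (ℕ; _∸_; NonZero)
open import Data.Nat.DivMod using (_%_; _/_)
open import Data.Product using (_×_; proj₁)
open import Relation.Binary.PropositionalEquality using (_≡_)

open import Data.Nat using (zero; suc; pred; _+_; _*_; _≤_; _<_; _<ᵇ_; _≤ᵇ_; _≡ᵇ_; _≤?_; _<?_; z≤n; s≤s; >-nonZero; >-nonZero⁻¹)
open import Data.Nat.Properties
open import Data.Nat.DivMod using (%-distribˡ-+; [m+n]%n≡m%n; m%n%n≡m%n; m%n<n; m<n⇒m%n≡m; m*n/n≡m)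
open import Data.Nat.Induction using (<-rec)
open import Data.Nat.ListAction using (sum)
open import Data.Fin as Fin using (Fin; toℕ; fromℕ<)
import Data.Fin.Properties as Finₚ
open Finₚ using (toℕ-injective; toℕ<n; toℕ-fromℕ<; any?; all?)
open import Data.Bool using (Bool; true; false; T; not; _∧_; _∨_; _xor_; if_then_else_)
open import Data.Bool.Properties using () renaming (_≟_ to _≟ᵇ_)
open import Data.Bool.ListAction using (any)
open import Data.List using (map; allFin; tabulate)
open import Data.List.Properties using (map-tabulate)
open import Data.List.Relation.Unary.Any.Properties using (any⁺; any⁻; tabulate⁺; tabulate⁻)
open import Data.Sum using (_⊎_; inj₁; inj₂)
open import Data.Product using (Σ; _,_; proj₂)
open import Data.Empty using (⊥; ⊥-elim)
open import Data.Unit using (tt)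
open import Function using (_∘_)
open import Relation.Nullary using (¬_; Dec; yes; no)
open import Relation.Nullary.Decidable using (T?; ⌊_⌋; toWitness; fromWitness; map′; ¬?; decidable-stable; _×-dec_; _⊎-dec_; _→-dec_)
open import Relation.Binary.PropositionalEquality using (_≢_; refl; sym; trans; cong; cong₂; subst; module ≡-Reasoning)
open import Relation.Binary.Definitions using (Tri; tri<; tri≈; tri>)
open import Algebra.Properties.CommutativeMonoid.Sum +-0-commutativeMonoid
  using (sum-syntax; sum-cong-≗; ∑-distrib-+) renaming (sum to ∑)

-- Call a gap of a partition a pair b < b′ of consecutive elements of one block.  For a
-- noncrossing π whose blocks have size ≡ 1 (mod d), and n ≡ 1, the Kreweras dual has all
-- blocks ≡ 1 exactly when every gap has b′ − b ≡ 1: each gap of the dual is filled by a single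
-- block of π, and conversely.  With this description one shows that if π < σ in NC^d then
-- cutting d suitable consecutive π-blocks out of one block of σ gives τ ∈ NC^d with
-- π ≤ τ < σ and d more blocks than σ.  Hence along a cover relation the number of blocks drops
-- by exactly d, and every saturated chain from the discrete partition (n blocks, the only
-- minimal element) to π has length (n − |π|)/d; the full partition (one block) is the only
-- maximal element.

T-∧-intro : ∀ {a b} → T a → T b → T (a ∧ b)
T-∧-intro {true} _ y = y

T-∧-elimˡ : ∀ {a b} → T (a ∧ b) → T a
T-∧-elimˡ {true} _ = tt

T-∧-elimʳ : ∀ {a b} → T (a ∧ b) → T b
T-∧-elimʳ {true} y = y

T-not-intro : ∀ {a} → ¬ T a → T (not a)
T-not-intro {false} _ = tt
T-not-intro {true}  ¬a = ¬a tt

T-not-elim : ∀ {a} → T (not a) → ¬ T a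
T-not-elim {false} _ ()

T-∨-introˡ : ∀ {a b} → T a → T (a ∨ b)
T-∨-introˡ {true} _ = tt

T-∨-introʳ : ∀ {a b} → T b → T (a ∨ b)
T-∨-introʳ {true}  _ = tt
T-∨-introʳ {false} t = t

T-∨-elim : ∀ {a b} → T (a ∨ b) → T a ⊎ T b
T-∨-elim {true}  _ = inj₁ tt
T-∨-elim {false} t = inj₂ t

T-ext : ∀ {a b} → (T a → T b) → (T b → T a) → a ≡ b
T-ext {true}  {true}  _ _ = refl
T-ext {false} {false} _ _ = refl
T-ext {true}  {false} f _ = ⊥-elim (f tt)
T-ext {false} {true}  _ g = ⊥-elim (g tt)

-- Counting on Fin n


indicator : Bool → ℕ
indicator b = if b then 1 else 0

count : ∀ {n} → (Fin n → Bool) → ℕ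
count {n} P = ∑[ j < n ] indicator (P j)

∑-mono-≤ : ∀ {n} {f g : Fin n → ℕ} → (∀ i → f i ≤ g i) → ∑ f ≤ ∑ g
∑-mono-≤ {zero}  _   = z≤n
∑-mono-≤ {suc n} f≤g = +-mono-≤ (f≤g Fin.zero) (∑-mono-≤ (f≤g ∘ Fin.suc))

sum-map-allFin : ∀ {n} (f : Fin n → ℕ) → sum (map f (allFin n)) ≡ ∑ f
sum-map-allFin {n} f = trans (cong sum (map-tabulate (λ i → i) f)) (sum-tabulate f)
  where
  sum-tabulate : ∀ {m} (g : Fin m → ℕ) → sum (tabulate g) ≡ ∑ g
  sum-tabulate {zero}  g = refl
  sum-tabulate {suc m} g = cong (g Fin.zero +_) (sum-tabulate (g ∘ Fin.suc))

count-cong : ∀ {n} {P Q : Fin n → Bool} → (∀ j → T (P j) → T (Q j)) → (∀ j → T (Q j) → T (P j)) →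
             count P ≡ count Q
count-cong P⇒Q Q⇒P = sum-cong-≗ (λ j → cong indicator (T-ext (P⇒Q j) (Q⇒P j)))

count-mono : ∀ {n} {P Q : Fin n → Bool} → (∀ j → T (P j) → T (Q j)) → count P ≤ count Q
count-mono P⇒Q = ∑-mono-≤ (λ j → indicator-mono (P⇒Q j))
  where
  indicator-mono : ∀ {a b} → (T a → T b) → indicator a ≤ indicator b
  indicator-mono {false}        _ = z≤n
  indicator-mono {true} {true}  _ = ≤-refl
  indicator-mono {true} {false} f = ⊥-elim (f tt)

count-all : ∀ {n} → count {n} (λ _ → true) ≡ n
count-all {zero}  = refl
count-all {suc n} = cong suc (count-all {n})

count≤n : ∀ {n} (P : Fin n → Bool) → count P ≤ n
count≤n {n} P = subst (count P ≤_) (count-all {n}) (count-mono {P = P} {Q = λ _ → true} (λ _ _ → tt))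

count-none : ∀ {n} {P : Fin n → Bool} → (∀ j → ¬ T (P j)) → count P ≡ 0
count-none {zero}          _    = refl
count-none {suc n} {P} none with P Fin.zero in eq
... | true  = ⊥-elim (none Fin.zero (subst T (sym eq) tt))
... | false = count-none (none ∘ Fin.suc)

count-single : ∀ {n} {P : Fin n → Bool} (k : Fin n) → T (P k) → (∀ j → T (P j) → j ≡ k) → count P ≡ 1
count-single {suc n} {P} Fin.zero pk unique with P Fin.zero
... | true  = cong suc (count-none (λ j pj → Finₚ.0≢1+n (sym (unique (Fin.suc j) pj))))
... | false = ⊥-elim pk
count-single {suc n} {P} (Fin.suc k) pk unique with P Fin.zero in eq
... | true  = ⊥-elim (Finₚ.0≢1+n (unique Fin.zero (subst T (sym eq) tt)))
... | false = count-single k pk (λ j pj → Finₚ.suc-injective (unique (Fin.suc j) pj))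

count-point : ∀ {n} (k : Fin n) → count {n} (λ j → toℕ j ≡ᵇ toℕ k) ≡ 1
count-point k = count-single k (≡⇒≡ᵇ (toℕ k) (toℕ k) refl) (λ j → toℕ-injective ∘ ≡ᵇ⇒≡ (toℕ j) (toℕ k))

count-pos : ∀ {n} {P : Fin n → Bool} (k : Fin n) → T (P k) → 1 ≤ count P
count-pos {suc n} {P} Fin.zero pk with P Fin.zero
... | true = s≤s z≤n
count-pos {suc n} {P} (Fin.suc k) pk = ≤-trans (count-pos k pk) (m≤n+m _ (indicator (P Fin.zero)))

count-⊎ : ∀ {n} {P Q R : Fin n → Bool} →
          (∀ j → T (P j) → T (Q j) ⊎ T (R j)) → (∀ j → T (Q j) → T (P j)) → (∀ j → T (R j) → T (P j)) →
          (∀ j → T (Q j) → ¬ T (R j)) → count P ≡ count Q + count R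
count-⊎ {Q = Q} {R} P⇒Q⊎R Q⇒P R⇒P disjoint =
  trans (sum-cong-≗ (λ j → indicator-⊎ (P⇒Q⊎R j) (Q⇒P j) (R⇒P j) (disjoint j)))
        (∑-distrib-+ (indicator ∘ Q) (indicator ∘ R))
  where
  indicator-⊎ : ∀ {p q r} → (T p → T q ⊎ T r) → (T q → T p) → (T r → T p) → (T q → ¬ T r) →
                indicator p ≡ indicator q + indicator r
  indicator-⊎ {q = true}  {true}  _ _ _ disj = ⊥-elim (disj tt tt)
  indicator-⊎ {q = true}  {false} _ q⇒p _ _ = cong indicator (T-ext (λ _ → tt) (λ _ → q⇒p tt))
  indicator-⊎ {q = false} {true}  _ _ r⇒p _ = cong indicator (T-ext (λ _ → tt) (λ _ → r⇒p tt))
  indicator-⊎ {false} {q = false} {false} _ _ _ _ = refl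
  indicator-⊎ {true}  {q = false} {false} p⇒q⊎r _ _ _ with p⇒q⊎r tt
  ... | inj₁ ()
  ... | inj₂ ()


-- Abstract, so that X, lo, hi and j can be inferred from T (restrict X lo hi j).
abstract
  restrict : ∀ {n} → (Fin n → Bool) → ℕ → ℕ → Fin n → Bool
  restrict X lo hi j = X j ∧ ((lo <ᵇ toℕ j) ∧ (toℕ j ≤ᵇ hi))

  restrict-intro : ∀ {n} {X : Fin n → Bool} {lo hi j} → T (X j) → lo < toℕ j → toℕ j ≤ hi → T (restrict X lo hi j)
  restrict-intro x lo<j j≤hi = T-∧-intro x (T-∧-intro (<⇒<ᵇ lo<j) (≤⇒≤ᵇ j≤hi))

  restrict-member : ∀ {n} {X : Fin n → Bool} {lo hi j} → T (restrict X lo hi j) → T (X j)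
  restrict-member = T-∧-elimˡ

  restrict-lower : ∀ {n} {X : Fin n → Bool} {lo hi j} → T (restrict X lo hi j) → lo < toℕ j
  restrict-lower {X = X} {lo} {hi} {j} t = <ᵇ⇒< lo (toℕ j) (T-∧-elimˡ (T-∧-elimʳ {X j} t))

  restrict-upper : ∀ {n} {X : Fin n → Bool} {lo hi j} → T (restrict X lo hi j) → toℕ j ≤ hi
  restrict-upper {X = X} {lo} {hi} {j} t = ≤ᵇ⇒≤ (toℕ j) hi (T-∧-elimʳ {lo <ᵇ toℕ j} (T-∧-elimʳ {X j} t))

countIn : ∀ {n} → (Fin n → Bool) → ℕ → ℕ → ℕ
countIn X lo hi = count (restrict X lo hi)

countIn-split : ∀ {n} (X : Fin n → Bool) {lo mid hi} → lo ≤ mid → mid ≤ hi →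
                countIn X lo hi ≡ countIn X lo mid + countIn X mid hi
countIn-split X {lo} {mid} {hi} lo≤mid mid≤hi = count-⊎ split
  (λ j t → restrict-intro (restrict-member t) (restrict-lower t) (≤-trans (restrict-upper t) mid≤hi))
  (λ j t → restrict-intro (restrict-member t) (≤-<-trans lo≤mid (restrict-lower t)) (restrict-upper t))
  (λ j t u → <-irrefl refl (<-≤-trans (restrict-lower u) (restrict-upper t)))
  where
  split : ∀ j → T (restrict X lo hi j) → T (restrict X lo mid j) ⊎ T (restrict X mid hi j)
  split j t with toℕ j ≤? mid
  ... | yes j≤mid = inj₁ (restrict-intro (restrict-member t) (restrict-lower t) j≤mid)
  ... | no  j≰mid = inj₂ (restrict-intro (restrict-member t) (≰⇒> j≰mid) (restrict-upper t))

countIn-none : ∀ {n} (X : Fin n → Bool) {lo hi} → (∀ j → lo < toℕ j → toℕ j ≤ hi → ¬ T (X j)) →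
               countIn X lo hi ≡ 0
countIn-none X none = count-none (λ j t → none j (restrict-lower t) (restrict-upper t) (restrict-member t))

countIn-empty : ∀ {n} (X : Fin n → Bool) lo → countIn X lo lo ≡ 0
countIn-empty X lo = countIn-none X (λ j lo<j j≤lo _ → <-irrefl refl (<-≤-trans lo<j j≤lo))

countIn-single : ∀ {n} (X : Fin n → Bool) {lo} (k : Fin n) → lo < toℕ k → T (X k) →
                 (∀ j → lo < toℕ j → toℕ j < toℕ k → ¬ T (X j)) → countIn X lo (toℕ k) ≡ 1
countIn-single X {lo} k lo<k xk none = count-single k (restrict-intro xk lo<k ≤-refl) unique
  where
  unique : ∀ j → T (restrict X lo (toℕ k) j) → j ≡ k
  unique j t with <-cmp (toℕ j) (toℕ k)
  ... | tri< j<k _ _ = ⊥-elim (none j (restrict-lower t) j<k (restrict-member t))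
  ... | tri≈ _ j≡k _ = toℕ-injective j≡k
  ... | tri> _ _ k<j = ⊥-elim (<-irrefl refl (<-≤-trans k<j (restrict-upper t)))

countIn-all : ∀ {n} lo hi → lo ≤ hi → hi < n → countIn {n} (λ _ → true) lo hi ≡ hi ∸ lo
countIn-all {n} lo zero    z≤n _ = countIn-empty {n} _ 0
countIn-all {n} lo (suc hi) lo≤1+hi 1+hi<n with m≤n⇒m<n∨m≡n lo≤1+hi
... | inj₂ refl = trans (countIn-empty {n} _ (suc hi)) (sym (n∸n≡0 (suc hi)))
... | inj₁ lo<1+hi = begin
  countIn every lo (suc hi)                      ≡⟨ countIn-split every lo≤hi (n≤1+n hi) ⟩
  countIn every lo hi + countIn every hi (suc hi) ≡⟨ cong₂ _+_ (countIn-all lo hi lo≤hi (<⇒≤ 1+hi<n)) last ⟩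
  (hi ∸ lo) + 1                                  ≡⟨ +-comm (hi ∸ lo) 1 ⟩
  suc (hi ∸ lo)                                  ≡⟨ +-∸-assoc 1 lo≤hi ⟨
  suc hi ∸ lo                                    ∎
  where
  open ≡-Reasoning
  every : Fin n → Bool
  every _ = true
  lo≤hi = ≤-pred lo<1+hi
  k = fromℕ< 1+hi<n
  k≡1+hi : toℕ k ≡ suc hi
  k≡1+hi = toℕ-fromℕ< 1+hi<n
  last : countIn every hi (suc hi) ≡ 1
  last = subst (λ m → countIn every hi m ≡ 1) k≡1+hi
           (countIn-single every k (≤-reflexive (sym k≡1+hi)) tt
              (λ j hi<j j<k _ → <-irrefl refl (<-≤-trans j<k (subst (_≤ toℕ j) (sym k≡1+hi) hi<j))))

count≡1+countIn : ∀ {n} (X : Fin n → Bool) {lo hi : Fin n} → T (X lo) →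
                  (∀ j → T (X j) → toℕ lo ≤ toℕ j × toℕ j ≤ toℕ hi) → count X ≡ 1 + countIn X (toℕ lo) (toℕ hi)
count≡1+countIn X {lo} {hi} lo∈ bounds =
  trans (count-⊎ split (λ j t → subst (T ∘ X) (toℕ-injective (sym (is-lo t))) lo∈) (λ j → restrict-member)
                 (λ j t u → <-irrefl (sym (is-lo t)) (restrict-lower u)))
        (cong (_+ countIn X (toℕ lo) (toℕ hi)) (count-point lo))
  where
  is-lo : ∀ {j} → T (toℕ j ≡ᵇ toℕ lo) → toℕ j ≡ toℕ lo
  is-lo {j} = ≡ᵇ⇒≡ (toℕ j) (toℕ lo)
  split : ∀ j → T (X j) → T (toℕ j ≡ᵇ toℕ lo) ⊎ T (restrict X (toℕ lo) (toℕ hi) j)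
  split j j∈ with toℕ j ≟ toℕ lo
  ... | yes j≡lo = inj₁ (≡⇒≡ᵇ (toℕ j) (toℕ lo) j≡lo)
  ... | no  j≢lo = inj₂ (restrict-intro j∈ (≤∧≢⇒< (proj₁ (bounds j j∈)) (j≢lo ∘ sym)) (proj₂ (bounds j j∈)))


record Greatest {n} (P : Fin n → Bool) : Set where
  field
    max   : Fin n
    max∈  : T (P max)
    ≤-max : ∀ k → T (P k) → toℕ k ≤ toℕ max

record Least {n} (P : Fin n → Bool) : Set where
  field
    min   : Fin n
    min∈  : T (P min)
    min-≤ : ∀ k → T (P k) → toℕ min ≤ toℕ k

greatest : ∀ {n} (P : Fin n → Bool) (j : Fin n) → T (P j) → Greatest P
greatest {suc n} P j pj with any? (λ k → T? (P (Fin.suc k)))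
... | yes (k , pk) = record { max = Fin.suc max ; max∈ = max∈ ; ≤-max = bound }
  where
  open Greatest (greatest (P ∘ Fin.suc) k pk)
  bound : ∀ i → T (P i) → toℕ i ≤ toℕ (Fin.suc max)
  bound Fin.zero    _  = z≤n
  bound (Fin.suc i) pi = s≤s (≤-max i pi)
... | no none = record { max = Fin.zero ; max∈ = p0 j pj ; ≤-max = bound }
  where
  p0 : ∀ i → T (P i) → T (P Fin.zero)
  p0 Fin.zero    pi = pi
  p0 (Fin.suc i) pi = ⊥-elim (none (i , pi))
  bound : ∀ i → T (P i) → toℕ i ≤ 0
  bound Fin.zero    _  = z≤n
  bound (Fin.suc i) pi = ⊥-elim (none (i , pi))

least : ∀ {n} (P : Fin n → Bool) (j : Fin n) → T (P j) → Least P
least {suc n} P j pj with T? (P Fin.zero)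
... | yes p0 = record { min = Fin.zero ; min∈ = p0 ; min-≤ = λ _ _ → z≤n }
least {suc n} P Fin.zero    pj | no ¬p0 = ⊥-elim (¬p0 pj)
least {suc n} P (Fin.suc j) pj | no ¬p0 = record { min = Fin.suc min ; min∈ = min∈ ; min-≤ = bound }
  where
  open Least (least (P ∘ Fin.suc) j pj)
  bound : ∀ i → T (P i) → toℕ (Fin.suc min) ≤ toℕ i
  bound Fin.zero    pi = ⊥-elim (¬p0 pi)
  bound (Fin.suc i) pi = s≤s (min-≤ i pi)

-- Congruences modulo d


record Consecutive {n} (X : Fin n → Bool) (p q : Fin n) : Set where
  field
    left∈   : T (X p)
    right∈  : T (X q)
    ordered : toℕ p < toℕ q
    between∉ : ∀ r → toℕ p < toℕ r → toℕ r < toℕ q → ¬ T (X r)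

module Modulo (d : ℕ) .{{_ : NonZero d}} where

  infix 4 _≋_
  _≋_ : ℕ → ℕ → Set
  a ≋ b = a % d ≡ b % d

  ≋-+ : ∀ {a a′ b b′} → a ≋ a′ → b ≋ b′ → a + b ≋ a′ + b′
  ≋-+ {a} {a′} {b} {b′} a≋a′ b≋b′ = begin
    (a + b) % d                 ≡⟨ %-distribˡ-+ a b d ⟩
    (a % d + b % d) % d         ≡⟨ cong₂ (λ u v → (u + v) % d) a≋a′ b≋b′ ⟩
    (a′ % d + b′ % d) % d       ≡⟨ %-distribˡ-+ a′ b′ d ⟨
    (a′ + b′) % d               ∎
    where open ≡-Reasoning

  +d≋ : ∀ a → a + d ≋ a
  +d≋ a = [m+n]%n≡m%n a d

  ≋-cancelʳ : ∀ {a b} c → a + c ≋ b + c → a ≋ b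
  ≋-cancelʳ {a} {b} c a+c≋b+c = trans (sym (complete a)) (trans (≋-+ a+c≋b+c refl) (complete b))
    where
    complete : ∀ x → x + c + (d ∸ c % d) ≋ x
    complete x = begin
      (x + c + (d ∸ c % d)) % d       ≡⟨ ≋-+ {x + c} (≋-+ {x} refl (sym (m%n%n≡m%n c d))) refl ⟩
      (x + c % d + (d ∸ c % d)) % d   ≡⟨ cong (_% d) (+-assoc x (c % d) (d ∸ c % d)) ⟩
      (x + (c % d + (d ∸ c % d))) % d ≡⟨ cong (λ u → (x + u) % d) (m+[n∸m]≡n (<⇒≤ (m%n<n c d))) ⟩
      (x + d) % d                     ≡⟨ +d≋ x ⟩
      x % d                           ∎
      where open ≡-Reasoning

  ≋-cancelˡ : ∀ {a b} c → c + a ≋ c + b → a ≋ b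
  ≋-cancelˡ {a} {b} c c+a≋c+b = ≋-cancelʳ c (trans (cong (_% d) (+-comm a c)) (trans c+a≋c+b (cong (_% d) (+-comm c b))))

  ≋0⇒d≤ : ∀ {a} → a ≋ 0 → 1 ≤ a → d ≤ a
  ≋0⇒d≤ {a} a≋0 1≤a with d ≤? a
  ... | yes d≤a = d≤a
  ... | no  d≰a = ⊥-elim (<-irrefl (sym (trans (sym (m<n⇒m%n≡m (≰⇒> d≰a))) (trans a≋0 (m<n⇒m%n≡m 0<d)))) 1≤a)
    where
    0<d : 0 < d
    0<d = ≤-<-trans z≤n (≰⇒> d≰a)

  countIn-telescope : ∀ {n} (X M : Fin n → Bool) {x y : Fin n} → T (X x) → T (X y) → toℕ x ≤ toℕ y →
    (∀ {p q} → Consecutive X p q → toℕ x ≤ toℕ p → toℕ q ≤ toℕ y → countIn M (toℕ p) (toℕ q) ≋ 1) →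
    countIn M (toℕ x) (toℕ y) ≋ countIn X (toℕ x) (toℕ y)
  countIn-telescope {n} X M {x} {y} x∈ y∈ x≤y step = go (toℕ y) x≤y y∈ ≤-refl step
    where
    go : ∀ fuel {y} → toℕ x ≤ toℕ y → T (X y) → toℕ y ≤ fuel →
         (∀ {p q} → Consecutive X p q → toℕ x ≤ toℕ p → toℕ q ≤ toℕ y → countIn M (toℕ p) (toℕ q) ≋ 1) →
         countIn M (toℕ x) (toℕ y) ≋ countIn X (toℕ x) (toℕ y)
    go fuel {y} x≤y y∈ y≤fuel step with m≤n⇒m<n∨m≡n x≤y
    ... | inj₂ x≡y rewrite x≡y = cong (_% d) (trans (countIn-empty M (toℕ y)) (sym (countIn-empty X (toℕ y))))
    ... | inj₁ x<y with fuel
    ...   | zero = ⊥-elim (<-irrefl refl (<-≤-trans x<y (≤-trans y≤fuel z≤n)))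
    ...   | suc fuel′ = begin
      countIn M (toℕ x) (toℕ y) % d                                  ≡⟨ cong (_% d) (countIn-split M x≤p p≤y) ⟩
      (countIn M (toℕ x) (toℕ p) + countIn M (toℕ p) (toℕ y)) % d   ≡⟨ ≋-+ before-p (step last x≤p ≤-refl) ⟩
      (countIn X (toℕ x) (toℕ p) + 1) % d                           ≡⟨ cong (λ c → (countIn X (toℕ x) (toℕ p) + c) % d) y-alone ⟨
      (countIn X (toℕ x) (toℕ p) + countIn X (toℕ p) (toℕ y)) % d   ≡⟨ cong (_% d) (countIn-split X x≤p p≤y) ⟨
      countIn X (toℕ x) (toℕ y) % d                                  ∎
      where
      open ≡-Reasoning
      below-y : Fin n → Bool
      below-y j = X j ∧ (toℕ j <ᵇ toℕ y)
      open Greatest (greatest below-y x (T-∧-intro x∈ (<⇒<ᵇ x<y))) renaming (max to p)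
      p<y : toℕ p < toℕ y
      p<y = <ᵇ⇒< (toℕ p) (toℕ y) (T-∧-elimʳ {X p} max∈)
      x≤p = ≤-max x (T-∧-intro x∈ (<⇒<ᵇ x<y))
      p≤y = <⇒≤ p<y
      last : Consecutive X p y
      last = record { left∈ = T-∧-elimˡ max∈ ; right∈ = y∈ ; ordered = p<y
                    ; between∉ = λ r p<r r<y r∈ → <-irrefl refl (<-≤-trans p<r (≤-max r (T-∧-intro r∈ (<⇒<ᵇ r<y)))) }
      y-alone : countIn X (toℕ p) (toℕ y) ≡ 1
      y-alone = countIn-single X y p<y y∈ (Consecutive.between∉ last)
      before-p : countIn M (toℕ x) (toℕ p) ≋ countIn X (toℕ x) (toℕ p)
      before-p = go fuel′ x≤p (T-∧-elimˡ max∈) (≤-pred (<-≤-trans p<y y≤fuel))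
                   (λ c x≤p′ q≤p → step c x≤p′ (≤-trans q≤p p≤y))

  distance-telescope : ∀ {n} (X : Fin n → Bool) {x y : Fin n} → T (X x) → T (X y) → toℕ x ≤ toℕ y →
    (∀ {p q} → Consecutive X p q → toℕ x ≤ toℕ p → toℕ q ≤ toℕ y → toℕ q ∸ toℕ p ≋ 1) →
    toℕ y ∸ toℕ x ≋ countIn X (toℕ x) (toℕ y)
  distance-telescope {n} X {x} {y} x∈ y∈ x≤y step =
    trans (cong (_% d) (sym (countIn-all (toℕ x) (toℕ y) x≤y (toℕ<n y))))
          (countIn-telescope X (λ _ → true) x∈ y∈ x≤y λ {p} {q} c x≤p q≤y →
             trans (cong (_% d) (countIn-all (toℕ p) (toℕ q) (<⇒≤ (Consecutive.ordered c)) (toℕ<n q))) (step c x≤p q≤y))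

  diameter≋0 : ∀ {n} (X : Fin n → Bool) {lo hi : Fin n} → count X ≋ 1 → T (X lo) → T (X hi) →
    (∀ j → T (X j) → toℕ lo ≤ toℕ j × toℕ j ≤ toℕ hi) →
    (∀ {p q} → Consecutive X p q → toℕ q ∸ toℕ p ≋ 1) → toℕ hi ∸ toℕ lo ≋ 0
  diameter≋0 X {lo} {hi} count≋1 lo∈ hi∈ bounds step = trans
    (distance-telescope X lo∈ hi∈ (proj₁ (bounds hi hi∈)) (λ c _ _ → step c))
    (≋-cancelˡ 1 (trans (cong (_% d) (sym (count≡1+countIn X lo∈ bounds))) count≋1))

m<n⇒n∸m≡n∸[1+m]+1 : ∀ {m n} → m < n → n ∸ m ≡ n ∸ suc m + 1
m<n⇒n∸m≡n∸[1+m]+1 {m} {suc n} (s≤s m≤n) = trans (+-∸-assoc 1 m≤n) (+-comm 1 (n ∸ m))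

∸-nested-< : ∀ {b p q b′} → b ≤ p → p ≤ q → q < b′ → q ∸ p < b′ ∸ b
∸-nested-< {b} {p} {q} b≤p p≤q q<b′ = ≤-<-trans (∸-monoʳ-≤ q b≤p) (∸-monoˡ-< q<b′ (≤-trans b≤p p≤q))


-- Blocks, gaps and the Kreweras dual


point<point⇒< : ∀ {n} {a b : Fin n} → pos2 (inj₁ a) < pos2 (inj₁ b) → toℕ a < toℕ b
point<point⇒< {a = a} {b} 2a<2b = *-cancelˡ-< 2 (toℕ a) (toℕ b) 2a<2b

point<dual⇒≤ : ∀ {n} {a b : Fin n} → pos2 (inj₁ a) < pos2 (inj₂ b) → toℕ a ≤ toℕ b
point<dual⇒≤ 2a<1+2b = *-cancelˡ-≤ 2 (≤-pred 2a<1+2b)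

dual<point⇒< : ∀ {n} {a b : Fin n} → pos2 (inj₂ a) < pos2 (inj₁ b) → toℕ a < toℕ b
dual<point⇒< {a = a} {b} 1+2a<2b = *-cancelˡ-< 2 (toℕ a) (toℕ b) (<-trans (n<1+n _) 1+2a<2b)

dual<dual⇒< : ∀ {n} {a b : Fin n} → pos2 (inj₂ a) < pos2 (inj₂ b) → toℕ a < toℕ b
dual<dual⇒< {a = a} {b} 1+2a<1+2b = *-cancelˡ-< 2 (toℕ a) (toℕ b) (≤-pred 1+2a<1+2b)

≤⇒point<dual : ∀ {n} {a b : Fin n} → toℕ a ≤ toℕ b → pos2 (inj₁ a) < pos2 (inj₂ b)
≤⇒point<dual a≤b = s≤s (*-monoʳ-≤ 2 a≤b)

<⇒dual<point : ∀ {n} {a b : Fin n} → toℕ a < toℕ b → pos2 (inj₂ a) < pos2 (inj₁ b)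
<⇒dual<point {a = a} {b} a<b = subst (_≤ 2 * toℕ b) (cong suc (+-suc (toℕ a) (toℕ a + 0))) (*-monoʳ-≤ 2 a<b)

<ᵇ-true : ∀ {m n} → m < n → (m <ᵇ n) ≡ true
<ᵇ-true m<n = T-ext (λ _ → _) (λ _ → <⇒<ᵇ m<n)

<ᵇ-false : ∀ {m n} → n ≤ m → (m <ᵇ n) ≡ false
<ᵇ-false {m} {n} n≤m = T-ext (λ m<ᵇn → <-irrefl refl (<-≤-trans (<ᵇ⇒< m n m<ᵇn) n≤m)) (λ ())

data Position (lo hi z : ℕ) : Set where
  below  : z ≤ lo → Position lo hi z
  inside : lo < z → z ≤ hi → Position lo hi z
  above  : hi < z → Position lo hi z

position : ∀ lo hi z → Position lo hi z
position lo hi z with lo <? z | z ≤? hi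
... | no  lo≮z | _         = below (≮⇒≥ lo≮z)
... | yes lo<z | yes z≤hi  = inside lo<z z≤hi
... | yes _    | no  z≰hi  = above (≰⇒> z≰hi)

module Blocks {n : ℕ} (π : Partition n) where

  infix 4 _~_
  _~_ : Fin n → Fin n → Set
  a ~ b = T (rel π a b)

  ~-refl : ∀ a → a ~ a
  ~-refl = rel-refl π

  ~-sym : ∀ {a b} → a ~ b → b ~ a
  ~-sym {a} {b} = rel-sym π a b

  ~-trans : ∀ {a b c} → a ~ b → b ~ c → a ~ c
  ~-trans {a} {b} {c} = rel-trans π a b c

  ≁⇒≢ : ∀ {a b} → ¬ (a ~ b) → toℕ a ≢ toℕ b
  ≁⇒≢ {a} a≁b a≡b = a≁b (subst (a ~_) (toℕ-injective a≡b) (~-refl a))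

  Gap : Fin n → Fin n → Set
  Gap b b′ = Consecutive (rel π b) b b′

  consecutive⇒gap : ∀ {a p q} → Consecutive (rel π a) p q → Gap p q
  consecutive⇒gap {a} c = record
    { left∈ = ~-refl _ ; right∈ = ~-trans (~-sym left∈) right∈ ; ordered = ordered
    ; between∉ = λ r p<r r<q p~r → between∉ r p<r r<q (~-trans left∈ p~r) }
    where open Consecutive c

  gap? : ∀ b b′ → Dec (Gap b b′)
  gap? b b′ = map′ (λ (b~b′ , b<b′ , between∉) → record
                      { left∈ = ~-refl b ; right∈ = b~b′ ; ordered = b<b′ ; between∉ = between∉ })
                   (λ gap → Consecutive.right∈ gap , Consecutive.ordered gap , Consecutive.between∉ gap)
                   (T? (rel π b b′) ×-dec (toℕ b <? toℕ b′) ×-dec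
                    all? (λ r → (toℕ b <? toℕ r) →-dec (toℕ r <? toℕ b′) →-dec ¬? (T? (rel π b r))))

  Closed : ℕ → ℕ → Set
  Closed lo hi = ∀ a b → a ~ b → lo < toℕ a → toℕ a ≤ hi → lo < toℕ b × toℕ b ≤ hi

  -- The dual point x′ sits between x and x + 1, so it separates a from b iff exactly one of them exceeds x.
  separates : Fin n → Fin n → Fin n → Bool
  separates x a b = (toℕ x <ᵇ toℕ a) xor (toℕ x <ᵇ toℕ b)

  NotSeparated : Fin n → Fin n → Set
  NotSeparated x y = ∀ a b → a ~ b → separates x a b ≡ separates y a b

  kreweras : Partition n
  kreweras = record
    { rel       = λ x y → ⌊ notSeparated? x y ⌋
    ; rel-refl  = λ x → fromWitness (λ _ _ _ → refl)
    ; rel-sym   = λ x y s → fromWitness (λ a b a~b → sym (toWitness s a b a~b))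
    ; rel-trans = λ x y z s t → fromWitness (λ a b a~b → trans (toWitness s a b a~b) (toWitness t a b a~b))
    }
    where
    notSeparated? : ∀ x y → Dec (NotSeparated x y)
    notSeparated? x y = all? (λ a → all? (λ b → T? (rel π a b) →-dec (separates x a b ≟ᵇ separates y a b)))

  kreweras⇒notSeparated : ∀ {x y} → T (rel kreweras x y) → NotSeparated x y
  kreweras⇒notSeparated = toWitness

  notSeparated⇒kreweras : ∀ {x y} → NotSeparated x y → T (rel kreweras x y)
  notSeparated⇒kreweras = fromWitness

  both-inside : ∀ {x y a b} → toℕ x < toℕ a × toℕ a ≤ toℕ y → toℕ x < toℕ b × toℕ b ≤ toℕ y →
                separates x a b ≡ separates y a b
  both-inside (x<a , a≤y) (x<b , b≤y) =
    trans (cong₂ _xor_ (<ᵇ-true x<a) (<ᵇ-true x<b)) (sym (cong₂ _xor_ (<ᵇ-false a≤y) (<ᵇ-false b≤y)))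

  closed⇒notSeparated : ∀ {x y} → toℕ x ≤ toℕ y → Closed (toℕ x) (toℕ y) → NotSeparated x y
  closed⇒notSeparated {x} {y} x≤y closed a b a~b
    with (toℕ x <? toℕ a) ×-dec (toℕ a ≤? toℕ y) | (toℕ x <? toℕ b) ×-dec (toℕ b ≤? toℕ y)
  ... | yes (x<a , a≤y) | _ = both-inside (x<a , a≤y) (closed a b a~b x<a a≤y)
  ... | no _ | yes (x<b , b≤y) = both-inside (closed b a (~-sym a~b) x<b b≤y) (x<b , b≤y)
  ... | no a∉ | no b∉ = cong₂ _xor_ (outside a∉) (outside b∉)
    where
    outside : ∀ {z} → ¬ (toℕ x < toℕ z × toℕ z ≤ toℕ y) → (toℕ x <ᵇ toℕ z) ≡ (toℕ y <ᵇ toℕ z)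
    outside {z} z∉ with position (toℕ x) (toℕ y) (toℕ z)
    ... | below z≤x      = trans (<ᵇ-false z≤x) (sym (<ᵇ-false (≤-trans z≤x x≤y)))
    ... | inside x<z z≤y = ⊥-elim (z∉ (x<z , z≤y))
    ... | above y<z      = trans (<ᵇ-true (≤-<-trans x≤y y<z)) (sym (<ᵇ-true y<z))

  notSeparated⇒closed : ∀ {x y} → toℕ x ≤ toℕ y → NotSeparated x y → Closed (toℕ x) (toℕ y)
  notSeparated⇒closed {x} {y} x≤y notSep a b a~b x<a a≤y with position (toℕ x) (toℕ y) (toℕ b)
  ... | inside x<b b≤y = x<b , b≤y
  ... | below b≤x = ⊥-elim (subst T (begin
        true                 ≡⟨ cong₂ _xor_ (<ᵇ-true x<a) (<ᵇ-false b≤x) ⟨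
        separates x a b      ≡⟨ notSep a b a~b ⟩
        separates y a b      ≡⟨ cong₂ _xor_ (<ᵇ-false a≤y) (<ᵇ-false (≤-trans b≤x x≤y)) ⟩
        false                ∎) _)
    where open ≡-Reasoning
  ... | above y<b = ⊥-elim (subst T (begin
        true                 ≡⟨ cong₂ _xor_ (<ᵇ-false a≤y) (<ᵇ-true y<b) ⟨
        separates y a b      ≡⟨ notSep a b a~b ⟨
        separates x a b      ≡⟨ cong₂ _xor_ (<ᵇ-true x<a) (<ᵇ-true (≤-<-trans x≤y y<b)) ⟩
        false                ∎) _)
    where open ≡-Reasoning

  kreweras⇒closed : ∀ {x y} → toℕ x ≤ toℕ y → T (rel kreweras x y) → Closed (toℕ x) (toℕ y)
  kreweras⇒closed x≤y = notSeparated⇒closed x≤y ∘ kreweras⇒notSeparated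

  closed⇒kreweras : ∀ {x y} → toℕ x ≤ toℕ y → Closed (toℕ x) (toℕ y) → T (rel kreweras x y)
  closed⇒kreweras x≤y = notSeparated⇒kreweras ∘ closed⇒notSeparated x≤y

  kreweras-noncrossing : Noncrossing π → NoncrossingOn pos2 (joinRel π kreweras)
  kreweras-noncrossing nc (inj₁ a) (inj₁ b) (inj₁ c) (inj₁ e) a<b b<c c<e a~c b~e =
    nc a b c e (point<point⇒< a<b) (point<point⇒< b<c) (point<point⇒< c<e) a~c b~e
  kreweras-noncrossing nc (inj₁ a) (inj₂ b) (inj₁ c) (inj₂ e) a<b′ b′<c c<e′ a~c b~e′ =
    ⊥-elim (<-irrefl refl (<-≤-trans b<a (point<dual⇒≤ {a = a} {b} a<b′)))
    where
    b<c = dual<point⇒< {a = b} {c} b′<c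
    b<a = proj₁ (kreweras⇒closed (≤-trans (<⇒≤ b<c) (point<dual⇒≤ {a = c} {e} c<e′)) b~e′
                   c a (~-sym a~c) b<c (point<dual⇒≤ {a = c} {e} c<e′))
  kreweras-noncrossing nc (inj₂ a) (inj₁ b) (inj₂ c) (inj₁ e) a′<b b<c′ c′<e a~c′ b~e =
    ⊥-elim (<-irrefl refl (<-≤-trans (dual<point⇒< {a = c} {e} c′<e) e≤c))
    where
    a<b = dual<point⇒< {a = a} {b} a′<b
    b≤c = point<dual⇒≤ {a = b} {c} b<c′
    e≤c = proj₂ (kreweras⇒closed (≤-trans (<⇒≤ a<b) b≤c) a~c′ b e b~e a<b b≤c)
  kreweras-noncrossing nc (inj₂ a) (inj₂ b) (inj₂ c) (inj₂ e) a′<b′ b′<c′ c′<e′ a~c b~e =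
    closed⇒kreweras (<⇒≤ a<b) closed
    where
    a<b = dual<dual⇒< {a = a} {b} a′<b′
    b<c = dual<dual⇒< {a = b} {c} b′<c′
    c<e = dual<dual⇒< {a = c} {e} c′<e′
    closed : Closed (toℕ a) (toℕ b)
    closed u v u~v a<u u≤b with kreweras⇒closed (<⇒≤ (<-trans a<b b<c)) a~c u v u~v a<u (≤-trans u≤b (<⇒≤ b<c))
    ... | a<v , v≤c with toℕ v ≤? toℕ b
    ...   | yes v≤b = a<v , v≤b
    ...   | no  v≰b = ⊥-elim (<-irrefl refl (<-≤-trans b<u u≤b))
      where
      b<u = proj₁ (kreweras⇒closed (<⇒≤ (<-trans b<c c<e)) b~e v u (~-sym u~v) (≰⇒> v≰b) (≤-trans v≤c (<⇒≤ c<e)))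
  kreweras-noncrossing nc (inj₁ _) _ (inj₂ _) _ _ _ _ () _
  kreweras-noncrossing nc (inj₂ _) _ (inj₁ _) _ _ _ _ () _
  kreweras-noncrossing nc _ (inj₁ _) _ (inj₂ _) _ _ _ _ ()
  kreweras-noncrossing nc _ (inj₂ _) _ (inj₁ _) _ _ _ _ ()

  noncrossing-join⇒closed : ∀ τ → NoncrossingOn pos2 (joinRel π τ) →
                            ∀ {x y} → toℕ x ≤ toℕ y → T (rel τ x y) → Closed (toℕ x) (toℕ y)
  noncrossing-join⇒closed τ join-nc {x} {y} x≤y x~y u v u~v x<u u≤y with position (toℕ x) (toℕ y) (toℕ v)
  ... | inside x<v v≤y = x<v , v≤y
  ... | below v≤x = ⊥-elim (join-nc (inj₁ v) (inj₂ x) (inj₁ u) (inj₂ y)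
                       (≤⇒point<dual {a = v} {x} v≤x) (<⇒dual<point {a = x} {u} x<u) (≤⇒point<dual {a = u} {y} u≤y)
                       (~-sym u~v) x~y)
  ... | above y<v = ⊥-elim (join-nc (inj₂ x) (inj₁ u) (inj₂ y) (inj₁ v)
                       (<⇒dual<point {a = x} {u} x<u) (≤⇒point<dual {a = u} {y} u≤y) (<⇒dual<point {a = y} {v} y<v) x~y u~v)

  noncrossing-join⇒≤kreweras : ∀ τ → NoncrossingOn pos2 (joinRel π τ) → τ ≤P kreweras
  noncrossing-join⇒≤kreweras τ join-nc x y x~y with ≤-total (toℕ x) (toℕ y)
  ... | inj₁ x≤y = closed⇒kreweras x≤y (noncrossing-join⇒closed τ join-nc x≤y x~y)
  ... | inj₂ y≤x = rel-sym kreweras y x (closed⇒kreweras y≤x (noncrossing-join⇒closed τ join-nc y≤x (rel-sym τ x y x~y)))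

  kreweras-isDual : Noncrossing π → IsKrewerasDual π kreweras
  kreweras-isDual nc = kreweras-noncrossing nc , noncrossing-join⇒≤kreweras

  kreweras-unique : Noncrossing π → ∀ σ → IsKrewerasDual π σ → ∀ x y → rel σ x y ≡ rel kreweras x y
  kreweras-unique nc σ (σ-nc , σ-coarsest) x y =
    T-ext (noncrossing-join⇒≤kreweras σ σ-nc x y) (σ-coarsest kreweras (kreweras-noncrossing nc) x y)

  kreweras-gap-range : ∀ {b b′ y} → Gap b b′ → T (rel kreweras b y) → toℕ b ≤ toℕ y × toℕ y < toℕ b′
  kreweras-gap-range {b} {b′} {y} gap b~y with <-cmp (toℕ y) (toℕ b)
  ... | tri< y<b _ _ = ⊥-elim (<⇒≱ (Consecutive.ordered gap)
          (proj₂ (kreweras⇒closed (<⇒≤ y<b) (rel-sym kreweras b y b~y) b b′ (Consecutive.right∈ gap) y<b ≤-refl)))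
  ... | tri≈ _ y≡b _ = ≤-reflexive (sym y≡b) , subst (_< toℕ b′) (sym y≡b) (Consecutive.ordered gap)
  ... | tri> _ _ b<y with toℕ b′ ≤? toℕ y
  ...   | no  b′≰y = <⇒≤ b<y , ≰⇒> b′≰y
  ...   | yes b′≤y = ⊥-elim (<-irrefl refl
          (proj₁ (kreweras⇒closed (<⇒≤ b<y) b~y b′ b (~-sym (Consecutive.right∈ gap)) (Consecutive.ordered gap) b′≤y)))

  record GapAround (a w : Fin n) : Set where
    field
      lower upper : Fin n
      gap         : Gap lower upper
      a~lower     : a ~ lower
      lower<w     : toℕ lower < toℕ w
      w<upper     : toℕ w < toℕ upper

  gap-around : ∀ {a a′ w} → a ~ a′ → toℕ a < toℕ w → toℕ w < toℕ a′ → ¬ (a ~ w) → GapAround a w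
  gap-around {a} {a′} {w} a~a′ a<w w<a′ a≁w = record
    { lower = b ; upper = b′ ; a~lower = a~b ; lower<w = b<w ; w<upper = w<b′
    ; gap = record { left∈ = ~-refl b ; right∈ = ~-trans (~-sym a~b) a~b′ ; ordered = <-trans b<w w<b′
                   ; between∉ = between∉ } }
    where
    Before After : Fin n → Bool
    Before j = rel π a j ∧ (toℕ j <ᵇ toℕ w)
    After  j = rel π a j ∧ (toℕ w <ᵇ toℕ j)
    open Greatest (greatest Before a (T-∧-intro (~-refl a) (<⇒<ᵇ a<w))) renaming (max to b; max∈ to b∈; ≤-max to ≤b)
    open Least (least After a′ (T-∧-intro a~a′ (<⇒<ᵇ w<a′))) renaming (min to b′; min∈ to b′∈; min-≤ to b′≤)
    a~b = T-∧-elimˡ b∈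
    a~b′ = T-∧-elimˡ b′∈
    b<w = <ᵇ⇒< (toℕ b) (toℕ w) (T-∧-elimʳ {rel π a b} b∈)
    w<b′ = <ᵇ⇒< (toℕ w) (toℕ b′) (T-∧-elimʳ {rel π a b′} b′∈)
    between∉ : ∀ r → toℕ b < toℕ r → toℕ r < toℕ b′ → ¬ (b ~ r)
    between∉ r b<r r<b′ b~r with <-cmp (toℕ r) (toℕ w)
    ... | tri< r<w _ _ = <⇒≱ b<r (≤b r (T-∧-intro (~-trans a~b b~r) (<⇒<ᵇ r<w)))
    ... | tri≈ _ r≡w _ = a≁w (subst (a ~_) (toℕ-injective r≡w) (~-trans a~b b~r))
    ... | tri> _ _ w<r = <⇒≱ r<b′ (b′≤ r (T-∧-intro (~-trans a~b b~r) (<⇒<ᵇ w<r)))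

module NoncrossingBlocks {n : ℕ} (π : Partition n) (nc : Noncrossing π) where
  open Blocks π
  module Dual = Blocks kreweras

  ≁∧≤⇒< : ∀ {w u} → ¬ (w ~ u) → toℕ w ≤ toℕ u → toℕ w < toℕ u
  ≁∧≤⇒< w≁u w≤u = ≤∧≢⇒< w≤u (≁⇒≢ w≁u)

  interior-closed : ∀ {w z u v} → w ~ z → toℕ w < toℕ u → toℕ u < toℕ z → ¬ (w ~ u) → u ~ v →
                    toℕ w < toℕ v × toℕ v < toℕ z
  interior-closed {w} {z} {u} {v} w~z w<u u<z w≁u u~v with <-cmp (toℕ v) (toℕ w) | <-cmp (toℕ v) (toℕ z)
  ... | tri< v<w _ _ | _ = ⊥-elim (w≁u (~-trans (~-sym (nc v w u z v<w w<u u<z (~-sym u~v) w~z)) (~-sym u~v)))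
  ... | tri≈ _ v≡w _ | _ = ⊥-elim (w≁u (subst (_~ u) (toℕ-injective v≡w) (~-sym u~v)))
  ... | tri> _ _ w<v | tri< v<z _ _ = w<v , v<z
  ... | tri> _ _ _   | tri≈ _ v≡z _ = ⊥-elim (w≁u (~-trans w~z (subst (_~ u) (toℕ-injective v≡z) (~-sym u~v))))
  ... | tri> _ _ _   | tri> _ _ z<v = ⊥-elim (w≁u (nc w u z v w<u u<z z<v w~z u~v))

  hull-closed : ∀ {w z} → w ~ z → (∀ k → w ~ k → toℕ w ≤ toℕ k × toℕ k ≤ toℕ z) →
                ∀ u v → u ~ v → toℕ w ≤ toℕ u → toℕ u ≤ toℕ z → toℕ w ≤ toℕ v × toℕ v ≤ toℕ z
  hull-closed {w} {z} w~z hull u v u~v w≤u u≤z with T? (rel π w u)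
  ... | yes w~u = hull v (~-trans w~u u~v)
  ... | no  w≁u = <⇒≤ w<v , <⇒≤ v<z
    where
    u<z = ≤∧≢⇒< u≤z (λ u≡z → w≁u (subst (w ~_) (toℕ-injective (sym u≡z)) w~z))
    w<v = proj₁ (interior-closed w~z (≁∧≤⇒< w≁u w≤u) u<z w≁u u~v)
    v<z = proj₂ (interior-closed w~z (≁∧≤⇒< w≁u w≤u) u<z w≁u u~v)

  gap⇒kreweras : ∀ {b b′ y} → Gap b b′ → suc (toℕ y) ≡ toℕ b′ → T (rel kreweras b y)
  gap⇒kreweras {b} {b′} {y} gap 1+y≡b′ = closed⇒kreweras (≤-pred b<1+y) closed
    where
    open Consecutive gap
    b<1+y = subst (toℕ b <_) (sym 1+y≡b′) ordered
    closed : Closed (toℕ b) (toℕ y)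
    closed u v u~v b<u u≤y =
      let u<b′ = subst (toℕ u <_) 1+y≡b′ (s≤s u≤y)
          (b<v , v<b′) = interior-closed right∈ b<u u<b′ (between∉ u b<u u<b′) u~v
      in b<v , ≤-pred (subst (toℕ v <_) (sym 1+y≡b′) v<b′)

  block-hull⇒kreweras : ∀ {y w z} → toℕ w ≡ suc (toℕ y) → w ~ z →
                        (∀ k → w ~ k → toℕ w ≤ toℕ k × toℕ k ≤ toℕ z) → T (rel kreweras y z)
  block-hull⇒kreweras {y} {w} {z} w≡1+y w~z hull =
    closed⇒kreweras (<⇒≤ (subst (_≤ toℕ z) w≡1+y (proj₁ (hull z w~z)))) λ u v u~v y<u u≤z →
      let (w≤v , v≤z) = hull-closed w~z hull u v u~v (subst (_≤ toℕ u) (sym w≡1+y) y<u) u≤z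
      in subst (_≤ toℕ v) w≡1+y w≤v , v≤z

  dual-gap⇒block : ∀ {y y″ w} → Dual.Gap y y″ → toℕ w ≡ suc (toℕ y) →
                   (∀ j → w ~ j → toℕ w ≤ toℕ j × toℕ j ≤ toℕ y″) × w ~ y″
  dual-gap⇒block {y} {y″} {w} dual-gap w≡1+y = within , w~y″
    where
    open Consecutive dual-gap renaming (right∈ to y~y″; ordered to y<y″; between∉ to nothing-between)
    within : ∀ j → w ~ j → toℕ w ≤ toℕ j × toℕ j ≤ toℕ y″
    within j w~j = let (y<j , j≤y″) = kreweras⇒closed (<⇒≤ y<y″) y~y″ w j w~j (≤-reflexive (sym w≡1+y))
                                        (subst (_≤ toℕ y″) (sym w≡1+y) y<y″)
                   in subst (_≤ toℕ j) (sym w≡1+y) y<j , j≤y″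
    open Greatest (greatest (rel π w) w (~-refl w)) renaming (max to z; max∈ to w~z)
    hull : ∀ k → w ~ k → toℕ w ≤ toℕ k × toℕ k ≤ toℕ z
    hull k w~k = proj₁ (within k w~k) , ≤-max k w~k
    z≡y″ : toℕ z ≡ toℕ y″
    z≡y″ with m≤n⇒m<n∨m≡n (proj₂ (within z w~z))
    ... | inj₁ z<y″ = ⊥-elim (nothing-between z (subst (_≤ toℕ z) w≡1+y (proj₁ (hull z w~z))) z<y″
                                (block-hull⇒kreweras w≡1+y w~z hull))
    ... | inj₂ z≡y″ = z≡y″
    w~y″ : w ~ y″
    w~y″ = subst (w ~_) (toℕ-injective z≡y″) w~z


-- Membership in NC^d through gaps

blockSize≡count : ∀ {n} (π : Partition n) i → blockSize π i ≡ count (rel π i)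
blockSize≡count {n} π i = sum-map-allFin {n} (λ j → indicator (rel π i j))

block-count≋1 : ∀ {n} (d : ℕ) .{{_ : NonZero d}} (ρ : Partition n) → BlocksOneMod d ρ →
                ∀ i → count (rel ρ i) % d ≡ 1 % d
block-count≋1 d ρ ρ-blocks i = trans (cong (_% d) (sym (blockSize≡count ρ i))) (ρ-blocks i)

GapsOneMod : ∀ {n} (d : ℕ) .{{_ : NonZero d}} → Partition n → Set
GapsOneMod d π = ∀ {b b′} → Blocks.Gap π b b′ → (toℕ b′ ∸ toℕ b) % d ≡ 1 % d

module GapCharacterization {n : ℕ} (π : Partition n) (nc : Noncrossing π)
                           (d : ℕ) .{{_ : NonZero d}} (blocks : BlocksOneMod d π) where
  open Modulo d
  open Blocks π
  open NoncrossingBlocks π nc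

  dual-gap-length≋1 : ∀ {y y″} → Dual.Gap y y″ →
    (∀ {p q} → Gap p q → toℕ y < toℕ p → toℕ q ≤ toℕ y″ → toℕ q ∸ toℕ p ≋ 1) → toℕ y″ ∸ toℕ y ≋ 1
  dual-gap-length≋1 {y} {y″} dual-gap inner-gaps = begin
    (toℕ y″ ∸ toℕ y) % d          ≡⟨ cong (_% d) (m<n⇒n∸m≡n∸[1+m]+1 y<y″) ⟩
    (toℕ y″ ∸ suc (toℕ y) + 1) % d ≡⟨ cong (λ k → (toℕ y″ ∸ k + 1) % d) w≡1+y ⟨
    (toℕ y″ ∸ toℕ w + 1) % d      ≡⟨ ≋-+ block-diameter refl ⟩
    1 % d                         ∎
    where
    open ≡-Reasoning
    open Consecutive dual-gap renaming (ordered to y<y″)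
    1+y<n = <-≤-trans (s≤s y<y″) (toℕ<n y″)
    w = fromℕ< 1+y<n
    w≡1+y = toℕ-fromℕ< 1+y<n
    within = proj₁ (dual-gap⇒block dual-gap w≡1+y)
    w~y″ = proj₂ (dual-gap⇒block dual-gap w≡1+y)
    block-diameter : toℕ y″ ∸ toℕ w ≋ 0
    block-diameter = diameter≋0 (rel π w) (block-count≋1 d π blocks w) (~-refl w) w~y″ within λ c →
      let g = consecutive⇒gap c
      in inner-gaps g (subst (_≤ toℕ _) w≡1+y (proj₁ (within _ (Consecutive.left∈ c))))
                      (proj₂ (within _ (Consecutive.right∈ c)))

  -- By strong induction on b′ − b: the dual block of b spans [b, b′ − 1], and each of its gaps
  -- is filled by a block of π all of whose gaps are shorter.
  gaps-one-mod : BlocksOneMod d kreweras → GapsOneMod d π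
  gaps-one-mod dual-blocks {b} {b′} = <-rec Goal step (toℕ b′ ∸ toℕ b) refl
    where
    Goal : ℕ → Set
    Goal L = ∀ {b b′} → toℕ b′ ∸ toℕ b ≡ L → Gap b b′ → toℕ b′ ∸ toℕ b ≋ 1
    step : ∀ L → (∀ {L′} → L′ < L → Goal L′) → Goal L
    step _ shorter {b} {b′} refl gap = begin
      (toℕ b′ ∸ toℕ b) % d      ≡⟨ cong (λ k → (k ∸ toℕ b) % d) 1+y≡b′ ⟨
      (suc (toℕ y) ∸ toℕ b) % d ≡⟨ cong (_% d) (trans (+-∸-assoc 1 b≤y) (+-comm 1 (toℕ y ∸ toℕ b))) ⟩
      (toℕ y ∸ toℕ b + 1) % d   ≡⟨ ≋-+ dual-diameter refl ⟩
      1 % d                     ∎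
      where
      open ≡-Reasoning
      open Consecutive gap using (ordered)
      1+pred≡b′ : suc (pred (toℕ b′)) ≡ toℕ b′
      1+pred≡b′ = suc-pred (toℕ b′) {{>-nonZero (≤-<-trans z≤n ordered)}}
      y<n : pred (toℕ b′) < n
      y<n = subst (_≤ n) (sym 1+pred≡b′) (<⇒≤ (toℕ<n b′))
      y = fromℕ< y<n
      1+y≡b′ : suc (toℕ y) ≡ toℕ b′
      1+y≡b′ = trans (cong suc (toℕ-fromℕ< y<n)) 1+pred≡b′
      y<b′ : toℕ y < toℕ b′
      y<b′ = ≤-reflexive 1+y≡b′
      range : ∀ j → T (rel kreweras b j) → toℕ b ≤ toℕ j × toℕ j ≤ toℕ y
      range j b~j = proj₁ (kreweras-gap-range gap b~j) ,
                    ≤-pred (subst (toℕ j <_) (sym 1+y≡b′) (proj₂ (kreweras-gap-range gap b~j)))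
      b≤y = proj₁ (range y (gap⇒kreweras gap 1+y≡b′))
      dual-diameter : toℕ y ∸ toℕ b ≋ 0
      dual-diameter = diameter≋0 (rel kreweras b) (block-count≋1 d kreweras dual-blocks b) (rel-refl kreweras b)
        (gap⇒kreweras gap 1+y≡b′) range λ {p} {q} c →
          dual-gap-length≋1 (Dual.consecutive⇒gap c) λ g p<p′ q′≤q →
            shorter (∸-nested-< (≤-trans (proj₁ (range p (Consecutive.left∈ c))) (<⇒≤ p<p′)) (<⇒≤ (Consecutive.ordered g))
                       (≤-<-trans q′≤q (≤-<-trans (proj₂ (range q (Consecutive.right∈ c))) y<b′))) refl g

  module DualBlock (n≋1 : n ≋ 1) (gaps : GapsOneMod d π) (x : Fin n) where

    D : Fin n → Bool
    D = rel kreweras x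

    open Least (least D x (rel-refl kreweras x)) renaming (min to lo; min∈ to lo∈; min-≤ to lo≤)
    open Greatest (greatest D x (rel-refl kreweras x)) renaming (max to hi; max∈ to hi∈; ≤-max to ≤hi)

    hi~⇒∈D : ∀ {z} → T (rel kreweras hi z) → T (D z)
    hi~⇒∈D = rel-trans kreweras x hi _ hi∈

    lo≤hi : toℕ lo ≤ toℕ hi
    lo≤hi = lo≤ hi hi∈

    lo-hi-closed : Closed (toℕ lo) (toℕ hi)
    lo-hi-closed = kreweras⇒closed lo≤hi (rel-trans kreweras lo x hi (rel-sym kreweras x lo lo∈) hi∈)

    -- The block of hi + 1 reaches back to lo, and (lo, hi + 1) is one of its gaps.
    diameter≋0-before-end : suc (toℕ hi) < n → toℕ hi ∸ toℕ lo ≋ 0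
    diameter≋0-before-end 1+hi<n = ≋-cancelʳ 1 (begin
      (toℕ hi ∸ toℕ lo + 1) % d     ≡⟨ cong (_% d) (trans (+-comm _ 1) (sym (+-∸-assoc 1 lo≤hi))) ⟩
      (suc (toℕ hi) ∸ toℕ lo) % d   ≡⟨ cong₂ (λ a b → (a ∸ b) % d) (sym h≡1+hi) (sym m≡lo) ⟩
      (toℕ h ∸ toℕ m) % d           ≡⟨ gaps gap ⟩
      1 % d                         ∎)
      where
      open ≡-Reasoning
      h = fromℕ< 1+hi<n
      h≡1+hi = toℕ-fromℕ< 1+hi<n
      Before : Fin n → Bool
      Before j = rel π h j ∧ (toℕ j ≤ᵇ toℕ hi)
      reaches-back : Σ (Fin n) (λ j → T (Before j))
      reaches-back with any? (λ j → T? (Before j))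
      ... | yes found = found
      ... | no  none  = ⊥-elim (<-irrefl refl (<-≤-trans hi<z (≤hi z (hi~⇒∈D hi~z))))
        where
        open Greatest (greatest (rel π h) h (~-refl h)) renaming (max to z; max∈ to h~z; ≤-max to ≤z)
        hull : ∀ k → h ~ k → toℕ h ≤ toℕ k × toℕ k ≤ toℕ z
        hull k h~k with toℕ k ≤? toℕ hi
        ... | yes k≤hi = ⊥-elim (none (k , T-∧-intro h~k (≤⇒≤ᵇ k≤hi)))
        ... | no  k≰hi = subst (_≤ toℕ k) (sym h≡1+hi) (≰⇒> k≰hi) , ≤z k h~k
        hi~z = block-hull⇒kreweras h≡1+hi h~z hull
        hi<z = subst (_≤ toℕ z) h≡1+hi (proj₁ (hull z h~z))
      open Greatest (greatest Before (proj₁ reaches-back) (proj₂ reaches-back))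
        renaming (max to m; max∈ to m∈; ≤-max to ≤m)
      m~h : m ~ h
      m~h = ~-sym (T-∧-elimˡ m∈)
      m≤hi : toℕ m ≤ toℕ hi
      m≤hi = ≤ᵇ⇒≤ (toℕ m) (toℕ hi) (T-∧-elimʳ {rel π h m} m∈)
      gap : Gap m h
      gap = record
        { left∈ = ~-refl m ; right∈ = m~h ; ordered = ≤-<-trans m≤hi (≤-reflexive (sym h≡1+hi))
        ; between∉ = λ r m<r r<h m~r → <-irrefl refl (<-≤-trans m<r (≤m r
            (T-∧-intro (~-trans (~-sym m~h) m~r) (≤⇒≤ᵇ (≤-pred (subst (toℕ r <_) h≡1+hi r<h)))))) }
      m≡lo : toℕ m ≡ toℕ lo
      m≡lo = ≤-antisym (≮⇒≥ λ lo<m → <-irrefl h≡1+hi (s≤s (proj₂ (lo-hi-closed m h m~h lo<m m≤hi))))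
                       (lo≤ m (hi~⇒∈D (rel-sym kreweras m hi (gap⇒kreweras gap (sym h≡1+hi)))))

    -- Here lo is the last point of the block of 0, so lo ≡ 0, and hi = n − 1 ≡ 0.
    diameter≋0-at-end : suc (toℕ hi) ≡ n → toℕ hi ∸ toℕ lo ≋ 0
    diameter≋0-at-end 1+hi≡n = ≋-cancelʳ (toℕ lo) (begin
      (toℕ hi ∸ toℕ lo + toℕ lo) % d  ≡⟨ cong (_% d) (m∸n+n≡m lo≤hi) ⟩
      toℕ hi % d                      ≡⟨ ≋-cancelʳ 1 (trans (cong (_% d) (trans (+-comm _ 1) 1+hi≡n)) n≋1) ⟩
      0 % d                           ≡⟨ sym lo≋0 ⟩
      toℕ lo % d                      ∎)
      where
      open ≡-Reasoning
      0<n = ≤-<-trans z≤n (toℕ<n x)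
      o = fromℕ< 0<n
      o≡0 = toℕ-fromℕ< 0<n
      ≤hi′ : ∀ v → toℕ v ≤ toℕ hi
      ≤hi′ v = ≤-pred (subst (toℕ v <_) (sym 1+hi≡n) (toℕ<n v))
      open Greatest (greatest (rel π o) o (~-refl o)) renaming (max to z; max∈ to o~z; ≤-max to ≤z)
      hull : ∀ k → o ~ k → toℕ o ≤ toℕ k × toℕ k ≤ toℕ z
      hull k o~k = subst (_≤ toℕ k) (sym o≡0) z≤n , ≤z k o~k
      z~hi : T (rel kreweras z hi)
      z~hi = closed⇒kreweras (≤hi′ z) λ u v u~v z<u _ → ≰⇒> (λ v≤z → <⇒≱ z<u
               (proj₂ (hull-closed o~z hull v u (~-sym u~v) (subst (_≤ toℕ v) (sym o≡0) z≤n) v≤z))) , ≤hi′ v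
      lo≡z : toℕ lo ≡ toℕ z
      lo≡z = ≤-antisym (lo≤ z (hi~⇒∈D (rel-sym kreweras z hi z~hi)))
                       (≮⇒≥ λ lo<z → n≮0 (subst (toℕ lo <_) o≡0 (proj₁ (lo-hi-closed z o (~-sym o~z) lo<z (≤hi′ z)))))
      lo≋0 : toℕ lo ≋ 0
      lo≋0 = subst (λ k → k ≋ 0) (sym lo≡z) (subst (λ k → toℕ z ∸ k ≋ 0) o≡0
               (diameter≋0 (rel π o) (block-count≋1 d π blocks o) (~-refl o) o~z hull (gaps ∘ consecutive⇒gap)))

    hi∸lo≋0 : toℕ hi ∸ toℕ lo ≋ 0
    hi∸lo≋0 with suc (toℕ hi) <? n
    ... | yes 1+hi<n = diameter≋0-before-end 1+hi<n
    ... | no  1+hi≮n = diameter≋0-at-end (≤-antisym (toℕ<n hi) (≮⇒≥ 1+hi≮n))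

    count≋1 : count D ≋ 1
    count≋1 = begin
      count D % d                   ≡⟨ cong (_% d) (count≡1+countIn D lo∈ (λ j j∈ → lo≤ j j∈ , ≤hi j j∈)) ⟩
      (1 + countIn D (toℕ lo) (toℕ hi)) % d ≡⟨ ≋-+ {1} refl (distance-telescope D lo∈ hi∈ lo≤hi λ c _ _ →
                                           dual-gap-length≋1 (Dual.consecutive⇒gap c) (λ g _ _ → gaps g)) ⟨
      (1 + (toℕ hi ∸ toℕ lo)) % d   ≡⟨ ≋-+ {1} refl hi∸lo≋0 ⟩
      1 % d                         ∎
      where open ≡-Reasoning

  kreweras-blocks-one-mod : n ≋ 1 → GapsOneMod d π → BlocksOneMod d kreweras
  kreweras-blocks-one-mod n≋1 gaps x = trans (cong (_% d) (blockSize≡count kreweras x)) (DualBlock.count≋1 n≋1 gaps x)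


-- Refining by d blocks

none⇒not-any : ∀ {n} {p : Fin n → Bool} → (∀ j → ¬ T (p j)) → T (not (any p (allFin n)))
none⇒not-any {n} {p} none with any p (allFin n) in eq
... | false = tt
... | true  = let (j , pj) = tabulate⁻ (any⁻ p (allFin n) (subst T (sym eq) tt)) in none j pj

not-any⇒none : ∀ {n} {p : Fin n → Bool} → T (not (any p (allFin n))) → ∀ j → ¬ T (p j)
not-any⇒none {n} {p} t j pj with any p (allFin n) in eq
... | false = subst T eq (any⁺ p (tabulate⁺ j pj))

isLeader : ∀ {n} → Partition n → Fin n → Bool
isLeader {n} X i = not (any (λ j → (toℕ j <ᵇ toℕ i) ∧ rel X j i) (allFin n))

isLeader-intro : ∀ {n} (X : Partition n) {i} → (∀ j → toℕ j < toℕ i → ¬ T (rel X j i)) → T (isLeader X i)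
isLeader-intro X {i} none = none⇒not-any λ j t → none j (<ᵇ⇒< _ _ (T-∧-elimˡ t)) (T-∧-elimʳ {toℕ j <ᵇ toℕ i} t)

isLeader-elim : ∀ {n} (X : Partition n) {i} → T (isLeader X i) → ∀ j → toℕ j < toℕ i → ¬ T (rel X j i)
isLeader-elim X {i} t j j<i j~i = not-any⇒none t j (T-∧-intro (<⇒<ᵇ j<i) j~i)

isLast : ∀ {n} → Partition n → Fin n → Bool
isLast {n} X i = not (any (λ j → (toℕ i <ᵇ toℕ j) ∧ rel X i j) (allFin n))

isLast-intro : ∀ {n} (X : Partition n) {i} → (∀ j → toℕ i < toℕ j → ¬ T (rel X i j)) → T (isLast X i)
isLast-intro X {i} none = none⇒not-any λ j t → none j (<ᵇ⇒< _ _ (T-∧-elimˡ t)) (T-∧-elimʳ {toℕ i <ᵇ toℕ j} t)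

isLast-elim : ∀ {n} (X : Partition n) {i} → T (isLast X i) → ∀ j → toℕ i < toℕ j → ¬ T (rel X i j)
isLast-elim X {i} t j i<j i~j = not-any⇒none t j (T-∧-intro (<⇒<ᵇ i<j) i~j)

numBlocks≡count-leaders : ∀ {n} (X : Partition n) → numBlocks X ≡ count (isLeader X)
numBlocks≡count-leaders {n} X = trans (sum-map-allFin {n} (λ i → if earlier i then 0 else 1)) (sum-cong-≗ (if-not ∘ earlier))
  where
  earlier : Fin n → Bool
  earlier i = any (λ j → (toℕ j <ᵇ toℕ i) ∧ rel X j i) (allFin n)
  if-not : ∀ b → (if b then 0 else 1) ≡ indicator (not b)
  if-not true  = refl
  if-not false = refl

record Intermediate {n} (d : ℕ) .{{_ : NonZero d}} (π σ : Partition n) : Set where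
  field
    τ           : Partition n
    noncrossing : Noncrossing τ
    blocks      : BlocksOneMod d τ
    gaps        : GapsOneMod d τ
    π≤τ         : π ≤P τ
    τ≤σ         : τ ≤P σ
    σ≰τ         : ¬ (σ ≤P τ)
    numBlocks-τ : numBlocks τ ≡ numBlocks σ + d

module Refinement {n : ℕ} (π σ : Partition n) (π-nc : Noncrossing π) (σ-nc : Noncrossing σ) (π≤σ : π ≤P σ)
                  (d : ℕ) .{{_ : NonZero d}}
                  (π-blocks : BlocksOneMod d π) (σ-blocks : BlocksOneMod d σ)
                  (π-gaps : GapsOneMod d π) (σ-gaps : GapsOneMod d σ) where
  open Modulo d
  open Blocks π using () renaming (_~_ to _~π_; ~-refl to π-refl; ~-sym to π-sym; ~-trans to π-trans)
  open Blocks σ using () renaming (_~_ to _~σ_; ~-refl to σ-refl; ~-sym to σ-sym; ~-trans to σ-trans)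

  Segment : Fin n → Fin n → Fin n → Bool
  Segment g hi = restrict (rel σ g) (toℕ g) (toℕ hi)

  -- τ is σ with the segment W of the σ-block S of g cut into its π-blocks.
  module SplitOff (g hi : Fin n) (g~hi : g ~σ hi) (g<hi : toℕ g < toℕ hi)
                  (W-closed : ∀ {j j′} → T (Segment g hi j) → j ~π j′ → T (Segment g hi j′))
                  (W-count : count (Segment g hi) ≋ d)
                  (W-leaders : count (λ i → Segment g hi i ∧ isLeader π i) ≡ d) where

    S W : Fin n → Bool
    S = rel σ g
    W = Segment g hi

    W-intro : ∀ {j} → g ~σ j → toℕ g < toℕ j → toℕ j ≤ toℕ hi → T (W j)
    W-intro = restrict-intro

    W⊆S : ∀ {j} → T (W j) → g ~σ j
    W⊆S = restrict-member

    g∉W : ¬ T (W g)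
    g∉W g∈W = <-irrefl refl (restrict-lower g∈W)

    hi∈W : T (W hi)
    hi∈W = W-intro g~hi g<hi ≤-refl

    _~τ_ : Fin n → Fin n → Set
    x ~τ y = x ~σ y × (T (W x) ⊎ T (W y) → x ~π y)

    τ-trans : ∀ {x y z} → x ~τ y → y ~τ z → x ~τ z
    τ-trans {x} {y} {z} (x~y , W⇒x~y) (y~z , W⇒y~z) = σ-trans x~y y~z , λ where
      (inj₁ x∈W) → let x~πy = W⇒x~y (inj₁ x∈W) in π-trans x~πy (W⇒y~z (inj₁ (W-closed x∈W x~πy)))
      (inj₂ z∈W) → let y~πz = W⇒y~z (inj₂ z∈W) in π-trans (W⇒x~y (inj₂ (W-closed z∈W (π-sym y~πz)))) y~πz

    τ-sym : ∀ {x y} → x ~τ y → y ~τ x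
    τ-sym (x~y , W⇒x~y) = σ-sym x~y , λ where
      (inj₁ y∈W) → π-sym (W⇒x~y (inj₂ y∈W))
      (inj₂ x∈W) → π-sym (W⇒x~y (inj₁ x∈W))

    τ-dec : ∀ x y → Dec (x ~τ y)
    τ-dec x y = T? (rel σ x y) ×-dec ((T? (W x) ⊎-dec T? (W y)) →-dec T? (rel π x y))

    τ : Partition n
    τ = record
      { rel       = λ x y → ⌊ τ-dec x y ⌋
      ; rel-refl  = λ x → fromWitness (σ-refl x , λ _ → π-refl x)
      ; rel-sym   = λ x y t → fromWitness (τ-sym (toWitness t))
      ; rel-trans = λ x y z s t → fromWitness (τ-trans (toWitness s) (toWitness t))
      }

    τ⇒ : ∀ {x y} → T (rel τ x y) → x ~τ y
    τ⇒ = toWitness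

    ⇒τ : ∀ {x y} → x ~τ y → T (rel τ x y)
    ⇒τ = fromWitness

    π≤τ : π ≤P τ
    π≤τ x y x~y = ⇒τ (π≤σ x y x~y , λ _ → x~y)

    τ≤σ : τ ≤P σ
    τ≤σ x y = proj₁ ∘ τ⇒

    σ≰τ : ¬ (σ ≤P τ)
    σ≰τ σ≤τ = g∉W (W-closed hi∈W (π-sym (proj₂ (τ⇒ (σ≤τ g hi g~hi)) (inj₂ hi∈W))))

    τ-noncrossing : Noncrossing τ
    τ-noncrossing a b c e a<b b<c c<e a~c b~e = ⇒τ (a~σb , a~πb ∘ both-in-W)
      where
      a~σb = σ-nc a b c e a<b b<c c<e (proj₁ (τ⇒ a~c)) (proj₁ (τ⇒ b~e))
      W⇒a~c = proj₂ (τ⇒ a~c)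
      W⇒b~e = proj₂ (τ⇒ b~e)
      both-in-W : T (W a) ⊎ T (W b) → T (W a) × T (W b)
      both-in-W (inj₁ a∈W) = a∈W , W-intro (σ-trans (W⊆S a∈W) a~σb) (<-trans (restrict-lower a∈W) a<b)
                                      (≤-trans (<⇒≤ b<c) (restrict-upper (W-closed a∈W (W⇒a~c (inj₁ a∈W)))))
      both-in-W (inj₂ b∈W) = W-closed c∈W (π-sym (W⇒a~c (inj₂ c∈W))) , b∈W
        where
        e∈W = W-closed b∈W (W⇒b~e (inj₁ b∈W))
        c∈W = W-intro (σ-trans (σ-trans (W⊆S b∈W) (σ-sym a~σb)) (proj₁ (τ⇒ a~c)))
                      (<-trans (restrict-lower b∈W) b<c) (≤-trans (<⇒≤ c<e) (restrict-upper e∈W))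
      a~πb : T (W a) × T (W b) → a ~π b
      a~πb (a∈W , b∈W) = π-nc a b c e a<b b<c c<e (W⇒a~c (inj₁ a∈W)) (W⇒b~e (inj₁ b∈W))

    Rest : Fin n → Bool
    Rest y = S y ∧ not (W y)

    W-row : ∀ {x y} → T (W x) → T (rel τ x y) → x ~π y
    W-row x∈W x~y = proj₂ (τ⇒ x~y) (inj₁ x∈W)

    outside-row : ∀ {x y} → ¬ g ~σ x → x ~σ y → T (rel τ x y)
    outside-row x∉S x~y = ⇒τ (x~y , λ where
      (inj₁ x∈W) → ⊥-elim (x∉S (W⊆S x∈W))
      (inj₂ y∈W) → ⊥-elim (x∉S (σ-trans (W⊆S y∈W) (σ-sym x~y))))

    rest-row⇒ : ∀ {x y} → g ~σ x → ¬ T (W x) → T (rel τ x y) → T (Rest y)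
    rest-row⇒ x∈S x∉W x~y = let (x~σy , W⇒x~πy) = τ⇒ x~y in
      T-∧-intro (σ-trans x∈S x~σy) (T-not-intro (λ y∈W → x∉W (W-closed y∈W (π-sym (W⇒x~πy (inj₂ y∈W))))))

    rest-row⇐ : ∀ {x y} → g ~σ x → ¬ T (W x) → T (Rest y) → T (rel τ x y)
    rest-row⇐ {y = y} x∈S x∉W y∈Rest = ⇒τ (σ-trans (σ-sym x∈S) (T-∧-elimˡ y∈Rest) , λ where
      (inj₁ x∈W) → ⊥-elim (x∉W x∈W)
      (inj₂ y∈W) → ⊥-elim (T-not-elim (T-∧-elimʳ {S y} y∈Rest) y∈W))

    Rest-count≋1 : count Rest ≋ 1
    Rest-count≋1 = ≋-cancelʳ d (begin
      (count Rest + d) % d           ≡⟨ ≋-+ {count Rest} refl (sym W-count) ⟩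
      (count Rest + count W) % d     ≡⟨ cong (_% d) S-split ⟨
      count S % d                    ≡⟨ block-count≋1 d σ σ-blocks g ⟩
      1 % d                          ≡⟨ +d≋ 1 ⟨
      (1 + d) % d                    ∎)
      where
      open ≡-Reasoning
      S-split : count S ≡ count Rest + count W
      S-split = count-⊎ (λ j j∈S → split (T? (W j)) j∈S) (λ _ → T-∧-elimˡ) (λ _ → W⊆S)
                        (λ j j∈Rest → T-not-elim (T-∧-elimʳ {S j} j∈Rest))
        where
        split : ∀ {j} → Dec (T (W j)) → T (S j) → T (Rest j) ⊎ T (W j)
        split (yes j∈W) _   = inj₂ j∈W
        split (no  j∉W) j∈S = inj₁ (T-∧-intro j∈S (T-not-intro j∉W))

    τ-blocks : BlocksOneMod d τ
    τ-blocks x = trans (cong (_% d) (blockSize≡count τ x)) (row (T? (W x)) (T? (S x)))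
      where
      row : Dec (T (W x)) → Dec (g ~σ x) → count (rel τ x) ≋ 1
      row (yes x∈W) _ = trans (cong (_% d) (count-cong {P = rel τ x} (λ _ → W-row x∈W) (π≤τ x)))
                              (block-count≋1 d π π-blocks x)
      row (no x∉W) (yes x∈S) = trans (cong (_% d) (count-cong {P = rel τ x} (λ _ → rest-row⇒ x∈S x∉W)
                                                                          (λ _ → rest-row⇐ x∈S x∉W)))
                                     Rest-count≋1
      row (no _) (no x∉S) = trans (cong (_% d) (count-cong {P = rel τ x} (τ≤σ x) (λ _ → outside-row x∉S)))
                                  (block-count≋1 d σ σ-blocks x)

    -- A gap of Rest that jumps over W can only be (g, u′), with u′ the next point of S after hi.
    gap-across-W : ∀ {u u′ w} → g ~σ u → ¬ T (W u) → Blocks.Gap τ u u′ →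
                   g ~σ w → toℕ u < toℕ w → toℕ w < toℕ u′ → toℕ u′ ∸ toℕ u ≋ 1
    gap-across-W {u} {u′} {w} u∈S u∉W gap w∈S u<w w<u′ = begin
      (toℕ u′ ∸ toℕ u) % d            ≡⟨ cong (λ k → (toℕ u′ ∸ k) % d) u≡g ⟩
      (toℕ u′ ∸ toℕ g) % d            ≡⟨ distance-telescope S (σ-refl g) u′∈S (<⇒≤ g<u′)
                                           (λ c _ _ → σ-gaps (Blocks.consecutive⇒gap σ c)) ⟩
      countIn S (toℕ g) (toℕ u′) % d  ≡⟨ cong (_% d) S-count ⟩
      (count W + 1) % d               ≡⟨ ≋-+ W-count refl ⟩
      (d + 1) % d                     ≡⟨ cong (_% d) (+-comm d 1) ⟩
      (1 + d) % d                     ≡⟨ +d≋ 1 ⟩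
      1 % d                           ∎
      where
      open ≡-Reasoning
      open Consecutive gap
      Rest⇒τ : ∀ {r} → T (Rest r) → T (rel τ u r)
      Rest⇒τ = rest-row⇐ u∈S u∉W
      w∈W : T (W w)
      w∈W with T? (W w)
      ... | yes w∈W = w∈W
      ... | no  w∉W = ⊥-elim (between∉ w u<w w<u′ (Rest⇒τ (T-∧-intro w∈S (T-not-intro w∉W))))
      g<w = restrict-lower w∈W
      g<u′ = <-trans g<w w<u′
      u≤g : toℕ u ≤ toℕ g
      u≤g = ≮⇒≥ λ g<u → u∉W (W-intro u∈S g<u (≤-trans (<⇒≤ u<w) (restrict-upper w∈W)))
      u≡g : toℕ u ≡ toℕ g
      u≡g = ≤-antisym u≤g (≮⇒≥ λ u<g → between∉ g u<g g<u′ (Rest⇒τ (T-∧-intro (σ-refl g) (T-not-intro g∉W))))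
      u′∈Rest = rest-row⇒ u∈S u∉W right∈
      u′∈S = T-∧-elimˡ u′∈Rest
      hi<u′ : toℕ hi < toℕ u′
      hi<u′ = ≰⇒> λ u′≤hi → T-not-elim (T-∧-elimʳ {S u′} u′∈Rest) (W-intro u′∈S g<u′ u′≤hi)
      S-count : countIn S (toℕ g) (toℕ u′) ≡ count W + 1
      S-count = trans (countIn-split S (<⇒≤ g<hi) (<⇒≤ hi<u′)) (cong (count W +_)
        (countIn-single S u′ hi<u′ u′∈S λ r hi<r r<u′ r∈S → between∉ r (≤-<-trans u≤g (<-trans g<hi hi<r)) r<u′
           (Rest⇒τ (T-∧-intro r∈S (T-not-intro λ r∈W → <⇒≱ hi<r (restrict-upper r∈W))))))

    τ-gaps : GapsOneMod d τ
    τ-gaps {u} {u′} gap = gap-kind (T? (W u)) (T? (S u))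
      where
      open Consecutive gap
      σ-gap : (∀ r → toℕ u < toℕ r → toℕ r < toℕ u′ → ¬ u ~σ r) → toℕ u′ ∸ toℕ u ≋ 1
      σ-gap nothing-between = σ-gaps (record
        { left∈ = σ-refl u ; right∈ = τ≤σ u u′ right∈ ; ordered = ordered ; between∉ = nothing-between })
      gap-kind : Dec (T (W u)) → Dec (g ~σ u) → toℕ u′ ∸ toℕ u ≋ 1
      gap-kind (yes u∈W) _ = π-gaps (record
        { left∈ = π-refl u ; right∈ = W-row u∈W right∈ ; ordered = ordered
        ; between∉ = λ r u<r r<u′ → between∉ r u<r r<u′ ∘ π≤τ u r })
      gap-kind (no _) (no u∉S) = σ-gap λ r u<r r<u′ → between∉ r u<r r<u′ ∘ outside-row u∉S
      gap-kind (no u∉W) (yes u∈S) with any? (λ w → T? (S w ∧ ((toℕ u <ᵇ toℕ w) ∧ (toℕ w <ᵇ toℕ u′))))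
      ... | yes (w , w∈) = gap-across-W u∈S u∉W gap (T-∧-elimˡ w∈)
                             (<ᵇ⇒< _ _ (T-∧-elimˡ (T-∧-elimʳ {S w} w∈)))
                             (<ᵇ⇒< _ _ (T-∧-elimʳ {toℕ u <ᵇ toℕ w} (T-∧-elimʳ {S w} w∈)))
      ... | no none = σ-gap λ r u<r r<u′ u~r →
                        none (r , T-∧-intro (σ-trans u∈S u~r) (T-∧-intro (<⇒<ᵇ u<r) (<⇒<ᵇ r<u′)))

    W-leader : Fin n → Bool
    W-leader i = W i ∧ isLeader π i

    leaders-split : count (isLeader τ) ≡ count (isLeader σ) + count W-leader
    leaders-split = count-⊎ τ-leader⇒ (λ _ → σ-leader⇒τ-leader) (λ _ → W-leader⇒τ-leader) disjoint
      where
      τ-leader⇒ : ∀ i → T (isLeader τ i) → T (isLeader σ i) ⊎ T (W-leader i)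
      τ-leader⇒ i lead = kind (T? (W i)) (T? (S i))
        where
        no-τ-earlier : ∀ {j} → toℕ j < toℕ i → T (rel τ i j) → ⊥
        no-τ-earlier {j} j<i i~j = isLeader-elim τ lead j j<i (rel-sym τ i j i~j)
        kind : Dec (T (W i)) → Dec (g ~σ i) → T (isLeader σ i) ⊎ T (W-leader i)
        kind (yes i∈W) _ = inj₂ (T-∧-intro i∈W (isLeader-intro π λ j j<i j~i → isLeader-elim τ lead j j<i (π≤τ j i j~i)))
        kind (no _) (no i∉S) = inj₁ (isLeader-intro σ λ j j<i j~i → no-τ-earlier j<i (outside-row i∉S (σ-sym j~i)))
        kind (no i∉W) (yes i∈S) = inj₁ (isLeader-intro σ λ j j<i j~i → earlier (T? (W j)) j<i j~i)
          where
          earlier : ∀ {j} → Dec (T (W j)) → toℕ j < toℕ i → j ~σ i → ⊥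
          earlier (yes j∈W) j<i _ = no-τ-earlier (<-trans (restrict-lower j∈W) j<i)
                                      (rest-row⇐ i∈S i∉W (T-∧-intro (σ-refl g) (T-not-intro g∉W)))
          earlier (no  j∉W) j<i j~i = no-τ-earlier j<i
                                        (rest-row⇐ i∈S i∉W (T-∧-intro (σ-trans i∈S (σ-sym j~i)) (T-not-intro j∉W)))
      σ-leader⇒τ-leader : ∀ {i} → T (isLeader σ i) → T (isLeader τ i)
      σ-leader⇒τ-leader lead = isLeader-intro τ λ j j<i j~i → isLeader-elim σ lead j j<i (τ≤σ j _ j~i)
      W-leader⇒τ-leader : ∀ {i} → T (W-leader i) → T (isLeader τ i)
      W-leader⇒τ-leader {i} t = isLeader-intro τ λ j j<i j~i →
        isLeader-elim π (T-∧-elimʳ {W i} t) j j<i (π-sym (W-row (T-∧-elimˡ t) (rel-sym τ j i j~i)))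
      disjoint : ∀ i → T (isLeader σ i) → ¬ T (W-leader i)
      disjoint i lead t = isLeader-elim σ lead g (restrict-lower (T-∧-elimˡ t)) (W⊆S (T-∧-elimˡ t))

    result : Intermediate d π σ
    result = record
      { τ = τ ; noncrossing = τ-noncrossing ; blocks = τ-blocks ; gaps = τ-gaps
      ; π≤τ = π≤τ ; τ≤σ = τ≤σ ; σ≰τ = σ≰τ
      ; numBlocks-τ = begin
          numBlocks τ                                  ≡⟨ numBlocks≡count-leaders τ ⟩
          count (isLeader τ)                           ≡⟨ leaders-split ⟩
          count (isLeader σ) + count W-leader          ≡⟨ cong₂ _+_ (sym (numBlocks≡count-leaders σ)) W-leaders ⟩
          numBlocks σ + d                              ∎
      }
      where open ≡-Reasoning

  record LastOfBlock (y : Fin n) : Set where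
    field
      last     : Fin n
      y~last   : y ~π last
      is-last  : T (isLast π last)
      ≤last    : ∀ k → y ~π k → toℕ k ≤ toℕ last

  last-of : ∀ y → LastOfBlock y
  last-of y = record { last = m ; y~last = y~m ; ≤last = ≤m
                     ; is-last = isLast-intro π λ k m<k m~k → <⇒≱ m<k (≤m k (π-trans y~m m~k)) }
    where open Greatest (greatest (rel π y) y (π-refl y)) renaming (max to m; max∈ to y~m; ≤-max to ≤m)

  module Window (g : Fin n) (e : ℕ) where

    S Y Z : Fin n → Bool
    S = rel σ g
    Y j = S j ∧ ((toℕ g <ᵇ toℕ j) ∧ (toℕ j <ᵇ e))
    Z j = (toℕ j ≡ᵇ toℕ g) ∨ (isLast π j ∧ Y j)

    S-leaders : Fin n → Bool
    S-leaders j = isLeader π j ∧ S j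

    Y-intro : ∀ {j} → g ~σ j → toℕ g < toℕ j → toℕ j < e → T (Y j)
    Y-intro j∈S g<j j<e = T-∧-intro j∈S (T-∧-intro (<⇒<ᵇ g<j) (<⇒<ᵇ j<e))

    Y⊆S : ∀ {j} → T (Y j) → g ~σ j
    Y⊆S = T-∧-elimˡ

    Y-lower : ∀ {j} → T (Y j) → toℕ g < toℕ j
    Y-lower {j} j∈Y = <ᵇ⇒< _ _ (T-∧-elimˡ (T-∧-elimʳ {S j} j∈Y))

    Y-upper : ∀ {j} → T (Y j) → toℕ j < e
    Y-upper {j} j∈Y = <ᵇ⇒< _ _ (T-∧-elimʳ {toℕ g <ᵇ toℕ j} (T-∧-elimʳ {S j} j∈Y))

    g∈Z : T (Z g)
    g∈Z = T-∨-introˡ (≡⇒≡ᵇ (toℕ g) (toℕ g) refl)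

    Z-intro : ∀ {z} → T (isLast π z) → T (Y z) → T (Z z)
    Z-intro {z} last z∈Y = T-∨-introʳ {toℕ z ≡ᵇ toℕ g} (T-∧-intro last z∈Y)

    g≤Z : ∀ {z} → T (Z z) → toℕ g ≤ toℕ z
    g≤Z {z} z∈Z with T-∨-elim {toℕ z ≡ᵇ toℕ g} z∈Z
    ... | inj₁ z≡g = ≤-reflexive (sym (≡ᵇ⇒≡ (toℕ z) (toℕ g) z≡g))
    ... | inj₂ t   = <⇒≤ (Y-lower (T-∧-elimʳ {isLast π z} t))

    Z-after-g : ∀ {z} → T (Z z) → toℕ g < toℕ z → T (isLast π z) × T (Y z)
    Z-after-g {z} z∈Z g<z with T-∨-elim {toℕ z ≡ᵇ toℕ g} z∈Z
    ... | inj₁ z≡g = ⊥-elim (<-irrefl (sym (≡ᵇ⇒≡ (toℕ z) (toℕ g) z≡g)) g<z)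
    ... | inj₂ t   = T-∧-elimˡ t , T-∧-elimʳ {isLast π z} t

    -- Under these hypotheses Y is a union of π-blocks lying one after another; their number is
    -- ≡ |Y| ≡ 0 and positive, hence at least d, and the first d of them form the segment cut out.
    module Splitting
      (Y-bounded : ∀ {y y′} → T (Y y) → y ~π y′ → toℕ g < toℕ y′ × toℕ y′ < e)
      (S∉gaps : ∀ {q q′} → Blocks.Gap π q q′ → T (Y q) → ∀ w → toℕ q < toℕ w → toℕ w < toℕ q′ → ¬ g ~σ w)
      (Y-count≋0 : count Y ≋ 0)
      (Y-nonempty : Σ (Fin n) (T ∘ Y)) where

      Y-closed : ∀ {y y′} → T (Y y) → y ~π y′ → T (Y y′)
      Y-closed {y} {y′} y∈Y y~y′ =
        Y-intro (σ-trans (Y⊆S y∈Y) (π≤σ y y′ y~y′)) (proj₁ (Y-bounded y∈Y y~y′)) (proj₂ (Y-bounded y∈Y y~y′))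

      S∉hull : ∀ {y m w} → T (Y y) → y ~π m → toℕ y < toℕ w → toℕ w < toℕ m → g ~σ w → ¬ y ~π w → ⊥
      S∉hull y∈Y y~m y<w w<m w∈S y≁w = S∉gaps gap (Y-closed y∈Y a~lower) _ lower<w w<upper w∈S
        where open Blocks.GapAround (Blocks.gap-around π y~m y<w w<m y≁w)

      -- Between consecutive points z < z′ of Z, the points of S are exactly the π-block of z′.
      module Consecutive-Z {z z′} (c : Consecutive Z z z′) where
        open Consecutive c renaming (left∈ to z∈Z; right∈ to z′∈Z; ordered to z<z′; between∉ to nothing-between)

        z′-last : T (isLast π z′)
        z′-last = proj₁ (Z-after-g z′∈Z (≤-<-trans (g≤Z z∈Z) z<z′))

        z′∈Y : T (Y z′)
        z′∈Y = proj₂ (Z-after-g z′∈Z (≤-<-trans (g≤Z z∈Z) z<z′))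

        S⇒block : ∀ j → toℕ z < toℕ j → toℕ j ≤ toℕ z′ → g ~σ j → z′ ~π j
        S⇒block j z<j j≤z′ j∈S with T? (rel π j z′)
        ... | yes j~z′ = π-sym j~z′
        ... | no  j≁z′ = ⊥-elim (case-last (<-cmp (toℕ m) (toℕ z′)))
          where
          j∈Y = Y-intro j∈S (≤-<-trans (g≤Z z∈Z) z<j) (≤-<-trans j≤z′ (Y-upper z′∈Y))
          open LastOfBlock (last-of j) renaming (last to m; y~last to j~m; is-last to m-last)
          j<z′ : toℕ j < toℕ z′
          j<z′ = ≤∧≢⇒< j≤z′ (Blocks.≁⇒≢ π j≁z′)
          case-last : Tri (toℕ m < toℕ z′) (toℕ m ≡ toℕ z′) (toℕ z′ < toℕ m) → ⊥
          case-last (tri< m<z′ _ _) = nothing-between m (<-≤-trans z<j (≤last j (π-refl j))) m<z′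
                                        (Z-intro m-last (Y-closed j∈Y j~m))
          case-last (tri≈ _ m≡z′ _) = j≁z′ (subst (j ~π_) (toℕ-injective m≡z′) j~m)
          case-last (tri> _ _ z′<m) = S∉hull j∈Y j~m j<z′ z′<m (Y⊆S z′∈Y) j≁z′

        block-inside : ∀ j → z′ ~π j → toℕ z < toℕ j × toℕ j ≤ toℕ z′
        block-inside j z′~j = z<j , j≤z′
          where
          j≤z′ : toℕ j ≤ toℕ z′
          j≤z′ = ≮⇒≥ λ z′<j → isLast-elim π z′-last j z′<j z′~j
          j∈Y = Y-closed z′∈Y z′~j
          z<j : toℕ z < toℕ j
          z<j with m≤n⇒m<n∨m≡n (g≤Z z∈Z)
          ... | inj₂ g≡z = subst (_< toℕ j) g≡z (Y-lower j∈Y)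
          ... | inj₁ g<z with Z-after-g z∈Z g<z | <-cmp (toℕ z) (toℕ j)
          ...   | _ | tri< z<j _ _ = z<j
          ...   | (z-last , _) | tri≈ _ z≡j _ =
                    ⊥-elim (isLast-elim π z-last z′ z<z′ (subst (_~π z′) (toℕ-injective (sym z≡j)) (π-sym z′~j)))
          ...   | (z-last , z∈Y) | tri> _ _ j<z with T? (rel π j z)
          ...     | yes j~z = ⊥-elim (isLast-elim π z-last z′ z<z′ (π-trans (π-sym j~z) (π-sym z′~j)))
          ...     | no  j≁z = ⊥-elim (S∉hull j∈Y (π-sym z′~j) j<z z<z′ (Y⊆S z∈Y) j≁z)

        S-count≋1 : countIn S (toℕ z) (toℕ z′) ≋ 1
        S-count≋1 = trans (cong (_% d) (count-cong
            (λ j t → S⇒block j (restrict-lower t) (restrict-upper t) (restrict-member t))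
            (λ j z′~j → restrict-intro (σ-trans (Y⊆S z′∈Y) (π≤σ z′ j z′~j)) (proj₁ (block-inside j z′~j))
                                       (proj₂ (block-inside j z′~j)))))
          (block-count≋1 d π π-blocks z′)

        leader-count≡1 : countIn S-leaders (toℕ z) (toℕ z′) ≡ 1
        leader-count≡1 = count-single q (restrict-intro (T-∧-intro q-leader q∈S) z<q q≤z′) unique
          where
          open Least (least (rel π z′) z′ (π-refl z′)) renaming (min to q; min∈ to z′~q; min-≤ to q≤)
          q-leader = isLeader-intro π λ j j<q j~q → <⇒≱ j<q (q≤ j (π-trans z′~q (π-sym j~q)))
          q∈S = σ-trans (Y⊆S z′∈Y) (π≤σ z′ q z′~q)
          z<q = proj₁ (block-inside q z′~q)
          q≤z′ = proj₂ (block-inside q z′~q)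
          unique : ∀ j → T (restrict S-leaders (toℕ z) (toℕ z′) j) → j ≡ q
          unique j t with <-cmp (toℕ j) (toℕ q)
          ... | tri< j<q _ _ = ⊥-elim (<⇒≱ j<q (q≤ j z′~j))
            where z′~j = S⇒block j (restrict-lower t) (restrict-upper t) (T-∧-elimʳ {isLeader π j} (restrict-member t))
          ... | tri≈ _ j≡q _ = toℕ-injective j≡q
          ... | tri> _ _ q<j = ⊥-elim (isLeader-elim π (T-∧-elimˡ (restrict-member t)) q q<j (π-trans (π-sym z′~q) z′~j))
            where z′~j = S⇒block j (restrict-lower t) (restrict-upper t) (T-∧-elimʳ {isLeader π j} (restrict-member t))

      S-telescope : ∀ {x y} → T (Z x) → T (Z y) → toℕ x ≤ toℕ y →
                    countIn S (toℕ x) (toℕ y) ≋ countIn Z (toℕ x) (toℕ y)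
      S-telescope x∈Z y∈Z x≤y = countIn-telescope Z S x∈Z y∈Z x≤y (λ c _ _ → Consecutive-Z.S-count≋1 c)

      Lasts : Fin n → Bool
      Lasts j = isLast π j ∧ Y j

      Lasts⇒Y : ∀ {j} → T (Lasts j) → T (Y j)
      Lasts⇒Y {j} = T-∧-elimʳ {isLast π j}

      Lasts⇒Z : ∀ {j} → T (Lasts j) → T (Z j)
      Lasts⇒Z j∈ = Z-intro (T-∧-elimˡ j∈) (Lasts⇒Y j∈)

      Lasts-count≋0 : count Lasts ≋ 0
      Lasts-count≋0 = begin
        count Lasts % d                       ≡⟨ cong (_% d) Z≡Lasts ⟨
        countIn Z (toℕ g) (toℕ zl) % d        ≡⟨ S-telescope g∈Z zl∈Z (g≤Z zl∈Z) ⟨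
        countIn S (toℕ g) (toℕ zl) % d        ≡⟨ cong (_% d) S≡Y ⟩
        count Y % d                           ≡⟨ Y-count≋0 ⟩
        0 % d                                 ∎
        where
        open ≡-Reasoning
        open Greatest (greatest Z g g∈Z) renaming (max to zl; max∈ to zl∈Z; ≤-max to ≤zl)
        S≡Y : countIn S (toℕ g) (toℕ zl) ≡ count Y
        S≡Y = count-cong
          (λ j t → Y-intro (restrict-member t) (restrict-lower t) (≤-<-trans (restrict-upper t)
                     (Y-upper (proj₂ (Z-after-g zl∈Z (<-≤-trans (restrict-lower t) (restrict-upper t)))))))
          (λ j j∈Y → let open LastOfBlock (last-of j) in
             restrict-intro (Y⊆S j∈Y) (Y-lower j∈Y) (≤-trans (≤last j (π-refl j)) (≤zl last (Z-intro is-last (Y-closed j∈Y y~last)))))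
        Z≡Lasts : countIn Z (toℕ g) (toℕ zl) ≡ count Lasts
        Z≡Lasts = count-cong
          (λ j t → let (j-last , j∈Y) = Z-after-g (restrict-member t) (restrict-lower t) in T-∧-intro j-last j∈Y)
          (λ j t → restrict-intro (Lasts⇒Z t) (Y-lower (Lasts⇒Y t)) (≤zl j (Lasts⇒Z t)))

      d≤Lasts : d ≤ count Lasts
      d≤Lasts = ≋0⇒d≤ Lasts-count≋0 (count-pos last (T-∧-intro is-last (Y-closed (proj₂ Y-nonempty) y~last)))
        where open LastOfBlock (last-of (proj₁ Y-nonempty))

      Z-point : ∀ k → k ≤ d → Σ (Fin n) λ z → T (Z z) × countIn Z (toℕ g) (toℕ z) ≡ k
      Z-point zero    _     = g , g∈Z , countIn-empty Z (toℕ g)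
      Z-point (suc k) 1+k≤d with Z-point k (≤-trans (n≤1+n k) 1+k≤d)
      ... | z , z∈Z , count≡k with any? (λ j → T? (Z j ∧ (toℕ z <ᵇ toℕ j)))
      ...   | no none = ⊥-elim (<⇒≱ 1+k≤d (≤-trans d≤Lasts Lasts≤k))
        where
        Lasts≤k : count Lasts ≤ k
        Lasts≤k = subst (count Lasts ≤_) count≡k (count-mono λ j t → restrict-intro (Lasts⇒Z t) (Y-lower (Lasts⇒Y t))
                    (≮⇒≥ λ z<j → none (j , T-∧-intro (Lasts⇒Z t) (<⇒<ᵇ z<j))))
      ...   | yes (j , j∈) = z′ , z′∈Z , count≡1+k
        where
        open Least (least (λ j → Z j ∧ (toℕ z <ᵇ toℕ j)) j j∈) renaming (min to z′; min∈ to z′∈; min-≤ to z′≤)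
        z′∈Z = T-∧-elimˡ z′∈
        z<z′ = <ᵇ⇒< (toℕ z) (toℕ z′) (T-∧-elimʳ {Z z′} z′∈)
        count≡1+k : countIn Z (toℕ g) (toℕ z′) ≡ suc k
        count≡1+k = trans (countIn-split Z (g≤Z z∈Z) (<⇒≤ z<z′)) (trans
          (cong₂ _+_ count≡k (countIn-single Z z′ z<z′ z′∈Z λ r z<r r<z′ r∈Z → <⇒≱ r<z′ (z′≤ r (T-∧-intro r∈Z (<⇒<ᵇ z<r)))))
          (+-comm k 1))

      hi : Fin n
      hi = proj₁ (Z-point d ≤-refl)

      hi∈Z : T (Z hi)
      hi∈Z = proj₁ (proj₂ (Z-point d ≤-refl))

      Z-count-hi : countIn Z (toℕ g) (toℕ hi) ≡ d
      Z-count-hi = proj₂ (proj₂ (Z-point d ≤-refl))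

      g<hi : toℕ g < toℕ hi
      g<hi with m≤n⇒m<n∨m≡n (g≤Z hi∈Z)
      ... | inj₁ g<hi = g<hi
      ... | inj₂ g≡hi = ⊥-elim (<-irrefl (trans (sym (countIn-empty Z (toℕ g)))
                                                (trans (cong (countIn Z (toℕ g)) g≡hi) Z-count-hi))
                                         (>-nonZero⁻¹ d))

      hi-last : T (isLast π hi)
      hi-last = proj₁ (Z-after-g hi∈Z g<hi)

      hi∈Y : T (Y hi)
      hi∈Y = proj₂ (Z-after-g hi∈Z g<hi)

      W-closed : ∀ {j j′} → T (Segment g hi j) → j ~π j′ → T (Segment g hi j′)
      W-closed {j} {j′} j∈W j~j′ = restrict-intro (Y⊆S j′∈Y) (Y-lower j′∈Y) j′≤hi
        where
        j∈Y = Y-intro (restrict-member j∈W) (restrict-lower j∈W) (≤-<-trans (restrict-upper j∈W) (Y-upper hi∈Y))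
        j′∈Y = Y-closed j∈Y j~j′
        open LastOfBlock (last-of j) renaming (last to m; y~last to j~m)
        j′≤hi : toℕ j′ ≤ toℕ hi
        j′≤hi with toℕ m ≤? toℕ hi
        ... | yes m≤hi = ≤-trans (≤last j′ j~j′) m≤hi
        ... | no  m≰hi with T? (rel π j hi)
        ...   | yes j~hi = ⊥-elim (isLast-elim π hi-last m (≰⇒> m≰hi) (π-trans (π-sym j~hi) j~m))
        ...   | no  j≁hi = ⊥-elim (S∉hull j∈Y j~m (≤∧≢⇒< (restrict-upper j∈W) (Blocks.≁⇒≢ π j≁hi)) (≰⇒> m≰hi) (Y⊆S hi∈Y) j≁hi)

      W-count : count (Segment g hi) ≋ d
      W-count = trans (S-telescope g∈Z hi∈Z (<⇒≤ g<hi)) (cong (_% d) Z-count-hi)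

      -- All counts are at most n, so a congruence modulo n + 1 between them is an equality.
      W-leaders : count (λ i → Segment g hi i ∧ isLeader π i) ≡ d
      W-leaders = begin
        count (λ i → Segment g hi i ∧ isLeader π i)     ≡⟨ count-cong
            (λ i t → restrict-intro (T-∧-intro (T-∧-elimʳ {Segment g hi i} t) (restrict-member (T-∧-elimˡ t)))
                                    (restrict-lower (T-∧-elimˡ t)) (restrict-upper (T-∧-elimˡ t)))
            (λ i t → T-∧-intro (restrict-intro (T-∧-elimʳ {isLeader π i} (restrict-member t)) (restrict-lower t) (restrict-upper t))
                               (T-∧-elimˡ (restrict-member t))) ⟩
        countIn S-leaders (toℕ g) (toℕ hi)              ≡⟨ m<n⇒m%n≡m (s≤s (count≤n _)) ⟨
        countIn S-leaders (toℕ g) (toℕ hi) % suc n      ≡⟨ Modulo.countIn-telescope (suc n) Z S-leaders g∈Z hi∈Z (<⇒≤ g<hi)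
                                                             (λ c _ _ → cong (_% suc n) (Consecutive-Z.leader-count≡1 c)) ⟩
        countIn Z (toℕ g) (toℕ hi) % suc n              ≡⟨ cong (_% suc n) Z-count-hi ⟩
        d % suc n                                       ≡⟨ m<n⇒m%n≡m (s≤s (subst (_≤ n) Z-count-hi (count≤n _))) ⟩
        d                                               ∎
        where open ≡-Reasoning

      intermediate : Intermediate d π σ
      intermediate = SplitOff.result g hi (Y⊆S hi∈Y) g<hi W-closed W-count W-leaders

  module Choose (a a′ : Fin n) (a~a′ : a ~σ a′) (a≁a′ : ¬ a ~π a′) where

    NestedGap : Fin n → Fin n → Set
    NestedGap q q′ = Blocks.Gap π q q′ × a ~σ q × Σ (Fin n) λ w → a ~σ w × toℕ q < toℕ w × toℕ w < toℕ q′

    nested? : ∀ q → Dec (Σ (Fin n) (NestedGap q))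
    nested? q = any? λ q′ → Blocks.gap? π q q′ ×-dec T? (rel σ a q) ×-dec
                            any? (λ w → T? (rel σ a w) ×-dec (toℕ q <? toℕ w) ×-dec (toℕ w <? toℕ q′))

    -- With q the last point starting a nested gap, no gap inside (q, q′) is nested.
    innermost : ∀ {q q′} → NestedGap q q′ → (∀ p p′ → NestedGap p p′ → toℕ p ≤ toℕ q) → Intermediate d π σ
    innermost {q} {q′} (gap , a~q , w , a~w , q<w , w<q′) last-nested =
      Splitting.intermediate Y-bounded S∉gaps Y-count≋0 (w , Y-intro (σ-trans (σ-sym a~q) a~w) q<w w<q′)
      where
      open Window q (toℕ q′)
      open Consecutive gap
      Y-bounded : ∀ {y y′} → T (Y y) → y ~π y′ → toℕ q < toℕ y′ × toℕ y′ < toℕ q′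
      Y-bounded {y} y∈Y y~y′ = NoncrossingBlocks.interior-closed π π-nc right∈ (Y-lower y∈Y) (Y-upper y∈Y)
                                 (between∉ y (Y-lower y∈Y) (Y-upper y∈Y)) y~y′
      S∉gaps : ∀ {p p′} → Blocks.Gap π p p′ → T (Y p) → ∀ v → toℕ p < toℕ v → toℕ v < toℕ p′ → ¬ q ~σ v
      S∉gaps {p} {p′} gap′ p∈Y v p<v v<p′ q~v = <⇒≱ (Y-lower p∈Y)
        (last-nested p p′ (gap′ , σ-trans a~q (Y⊆S p∈Y) , v , σ-trans a~q q~v , p<v , v<p′))
      S-split : countIn S (toℕ q) (toℕ q′) ≡ count Y + 1
      S-split = trans (count-⊎ split (λ j j∈Y → restrict-intro (Y⊆S j∈Y) (Y-lower j∈Y) (<⇒≤ (Y-upper j∈Y)))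
                                     (λ j j≡q′ → subst (λ k → T (restrict S (toℕ q) (toℕ q′) k)) (sym (is-q′ j≡q′))
                                                       (restrict-intro (π≤σ q q′ right∈) ordered ≤-refl))
                                     (λ j j∈Y j≡q′ → <-irrefl (cong toℕ (is-q′ j≡q′)) (Y-upper j∈Y)))
                      (cong (count Y +_) (count-point q′))
        where
        is-q′ : ∀ {j} → T (toℕ j ≡ᵇ toℕ q′) → j ≡ q′
        is-q′ {j} = toℕ-injective ∘ ≡ᵇ⇒≡ (toℕ j) (toℕ q′)
        split : ∀ j → T (restrict S (toℕ q) (toℕ q′) j) → T (Y j) ⊎ T (toℕ j ≡ᵇ toℕ q′)
        split j t with m≤n⇒m<n∨m≡n (restrict-upper t)
        ... | inj₁ j<q′ = inj₁ (Y-intro (restrict-member t) (restrict-lower t) j<q′)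
        ... | inj₂ j≡q′ = inj₂ (≡⇒≡ᵇ (toℕ j) (toℕ q′) j≡q′)
      Y-count≋0 : count Y ≋ 0
      Y-count≋0 = ≋-cancelʳ 1 (begin
        (count Y + 1) % d              ≡⟨ cong (_% d) S-split ⟨
        countIn S (toℕ q) (toℕ q′) % d ≡⟨ distance-telescope S (σ-refl q) (π≤σ q q′ right∈) (<⇒≤ ordered)
                                            (λ c _ _ → σ-gaps (Blocks.consecutive⇒gap σ c)) ⟨
        (toℕ q′ ∸ toℕ q) % d           ≡⟨ π-gaps gap ⟩
        1 % d                          ∎)
        where open ≡-Reasoning

    -- Without nested gaps, the σ-block of a starts with a whole π-block, ending at g;
    -- the rest of it is Y.
    flat : (∀ q q′ → ¬ NestedGap q q′) → Intermediate d π σ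
    flat none = Splitting.intermediate Y-bounded S∉gaps Y-count≋0 (proj₁ a≁s-block , outside-block⇒Y (proj₂ a≁s-block))
      where
      open Least (least (rel σ a) a (σ-refl a)) renaming (min to s; min∈ to a~s; min-≤ to s≤)
      open LastOfBlock (last-of s) renaming (last to g; y~last to s~g; ≤last to ≤g)
      a~g : a ~σ g
      a~g = σ-trans a~s (π≤σ s g s~g)
      open Window g n
      early⇒block : ∀ j → a ~σ j → toℕ j ≤ toℕ g → s ~π j
      early⇒block j a~j j≤g with T? (rel π s j)
      ... | yes s~j = s~j
      ... | no  s≁j = ⊥-elim (none lower upper (gap , σ-trans a~s (π≤σ s lower a~lower) , j , a~j , lower<w , w<upper))
        where
        s<j = ≤∧≢⇒< (s≤ j a~j) (Blocks.≁⇒≢ π s≁j)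
        j<g = ≤∧≢⇒< j≤g (λ j≡g → s≁j (subst (s ~π_) (toℕ-injective (sym j≡g)) s~g))
        open Blocks.GapAround (Blocks.gap-around π s~g s<j j<g s≁j)
      outside-block⇒Y : ∀ {j} → a ~σ j × ¬ s ~π j → T (Y j)
      outside-block⇒Y {j} (a~j , s≁j) =
        Y-intro (σ-trans (σ-sym a~g) a~j) (≰⇒> λ j≤g → s≁j (early⇒block j a~j j≤g)) (toℕ<n j)
      a≁s-block : Σ (Fin n) λ j → a ~σ j × ¬ s ~π j
      a≁s-block with T? (rel π s a)
      ... | yes s~a = a′ , a~a′ , λ s~a′ → a≁a′ (π-trans (π-sym s~a) s~a′)
      ... | no  s≁a = a , σ-refl a , s≁a
      Y-bounded : ∀ {y y′} → T (Y y) → y ~π y′ → toℕ g < toℕ y′ × toℕ y′ < n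
      Y-bounded {y} {y′} y∈Y y~y′ = ≰⇒> (λ y′≤g → <⇒≱ (Y-lower y∈Y) (≤g y (π-trans (early⇒block y′ a~y′ y′≤g) (π-sym y~y′))))
                                  , toℕ<n y′
        where a~y′ = σ-trans (σ-trans a~g (Y⊆S y∈Y)) (π≤σ y y′ y~y′)
      S∉gaps : ∀ {p p′} → Blocks.Gap π p p′ → T (Y p) → ∀ v → toℕ p < toℕ v → toℕ v < toℕ p′ → ¬ g ~σ v
      S∉gaps {p} {p′} gap p∈Y v p<v v<p′ g~v = none p p′ (gap , σ-trans a~g (Y⊆S p∈Y) , v , σ-trans a~g g~v , p<v , v<p′)
      S-split : count S ≡ count (rel π s) + count Y
      S-split = count-⊎ split (λ j s~j → σ-trans (σ-sym (π≤σ s g s~g)) (π≤σ s j s~j)) (λ _ → Y⊆S)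
                        (λ j s~j j∈Y → <⇒≱ (Y-lower j∈Y) (≤g j s~j))
        where
        split : ∀ j → g ~σ j → s ~π j ⊎ T (Y j)
        split j g~j with toℕ j ≤? toℕ g
        ... | yes j≤g = inj₁ (early⇒block j (σ-trans a~g g~j) j≤g)
        ... | no  j≰g = inj₂ (Y-intro g~j (≰⇒> j≰g) (toℕ<n j))
      Y-count≋0 : count Y ≋ 0
      Y-count≋0 = ≋-cancelˡ (count (rel π s)) (begin
        (count (rel π s) + count Y) % d   ≡⟨ cong (_% d) S-split ⟨
        count S % d                       ≡⟨ block-count≋1 d σ σ-blocks g ⟩
        1 % d                             ≡⟨ block-count≋1 d π π-blocks s ⟨
        count (rel π s) % d               ≡⟨ cong (_% d) (+-identityʳ _) ⟨
        (count (rel π s) + 0) % d         ∎)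
        where open ≡-Reasoning

    intermediate : Intermediate d π σ
    intermediate with any? nested?
    ... | no  none = flat (λ q q′ nested → none (q , q′ , nested))
    ... | yes (q₀ , q₀′ , nested₀) = innermost (proj₂ (toWitness q-nested)) λ p p′ nested →
                                       ≤q p (fromWitness {a? = nested? p} (p′ , nested))
      where
      open Greatest (greatest (λ q → ⌊ nested? q ⌋) q₀ (fromWitness {a? = nested? q₀} (q₀′ , nested₀)))
        renaming (max to q; max∈ to q-nested; ≤-max to ≤q)

  intermediate-exists : ¬ (σ ≤P π) → Intermediate d π σ
  intermediate-exists σ≰π with any? (λ a → any? λ a′ → T? (rel σ a a′) ×-dec ¬? (T? (rel π a a′)))
  ... | yes (a , a′ , a~a′ , a≁a′) = Choose.intermediate a a′ a~a′ a≁a′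
  ... | no  none = ⊥-elim (σ≰π λ a a′ a~a′ → decidable-stable (T? (rel π a a′)) λ a≁a′ → none (a , a′ , a~a′ , a≁a′))


-- Ranks

_≤P?_ : ∀ {n} (A B : Partition n) → Dec (A ≤P B)
A ≤P? B = all? λ i → all? λ j → T? (rel A i j) →-dec T? (rel B i j)

≤P-stable : ∀ {n} (A B : Partition n) → ¬ ¬ (A ≤P B) → A ≤P B
≤P-stable A B = decidable-stable (A ≤P? B)

numBlocks-cong : ∀ {n} (A B : Partition n) → A ≤P B → B ≤P A → numBlocks A ≡ numBlocks B
numBlocks-cong A B A≤B B≤A = begin
  numBlocks A          ≡⟨ numBlocks≡count-leaders A ⟩
  count (isLeader A)   ≡⟨ count-cong (λ i lead → isLeader-intro B λ j j<i j~i → isLeader-elim A lead j j<i (B≤A j i j~i))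
                                     (λ i lead → isLeader-intro A λ j j<i j~i → isLeader-elim B lead j j<i (A≤B j i j~i)) ⟩
  count (isLeader B)   ≡⟨ numBlocks≡count-leaders B ⟨
  numBlocks B          ∎
  where open ≡-Reasoning

discrete : ∀ {n} → Partition n
discrete = record
  { rel       = λ i j → toℕ i ≡ᵇ toℕ j
  ; rel-refl  = λ i → ≡⇒≡ᵇ (toℕ i) (toℕ i) refl
  ; rel-sym   = λ i j i≡j → ≡⇒≡ᵇ (toℕ j) (toℕ i) (sym (≡ᵇ⇒≡ (toℕ i) (toℕ j) i≡j))
  ; rel-trans = λ i j k i≡j j≡k → ≡⇒≡ᵇ (toℕ i) (toℕ k) (trans (≡ᵇ⇒≡ (toℕ i) (toℕ j) i≡j) (≡ᵇ⇒≡ (toℕ j) (toℕ k) j≡k))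
  }

discrete⇒≡ : ∀ {n} {i j : Fin n} → T (rel discrete i j) → toℕ i ≡ toℕ j
discrete⇒≡ {i = i} {j} = ≡ᵇ⇒≡ (toℕ i) (toℕ j)

discrete-least : ∀ {n} (A : Partition n) → discrete ≤P A
discrete-least A i j i≡j = subst (λ k → T (rel A i k)) (toℕ-injective (discrete⇒≡ i≡j)) (rel-refl A i)

numBlocks-discrete : ∀ {n} (A : Partition n) → A ≤P discrete → numBlocks A ≡ n
numBlocks-discrete {n} A A≤discrete = begin
  numBlocks A               ≡⟨ numBlocks≡count-leaders A ⟩
  count (isLeader A)        ≡⟨ count-cong (λ _ _ → tt) (λ i _ → isLeader-intro A λ j j<i j~i →
                                 <-irrefl (discrete⇒≡ (A≤discrete j i j~i)) j<i) ⟩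
  count {n} (λ _ → true)    ≡⟨ count-all ⟩
  n                         ∎
  where open ≡-Reasoning

full : ∀ {n} → Partition n
full = record { rel = λ _ _ → true ; rel-refl = λ _ → tt ; rel-sym = λ _ _ _ → tt ; rel-trans = λ _ _ _ _ _ → tt }

numBlocks-full : ∀ {n} (A : Partition n) → full ≤P A → 0 < n → numBlocks A ≡ 1
numBlocks-full A full≤A 0<n = trans (numBlocks≡count-leaders A) (count-single first first-leads only-first)
  where
  first = fromℕ< 0<n
  first≡0 = toℕ-fromℕ< 0<n
  first-leads : T (isLeader A first)
  first-leads = isLeader-intro A λ j j<first _ → n≮0 (subst (toℕ j <_) first≡0 j<first)
  only-first : ∀ j → T (isLeader A j) → j ≡ first
  only-first j lead = toℕ-injective (≤-antisym (≮⇒≥ λ first<j → isLeader-elim A lead first first<j (full≤A first j tt))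
                                               (subst (_≤ toℕ j) (sym first≡0) z≤n))

module NCPoset (d n : ℕ) .{{_ : NonZero d}} (n≋1 : n % d ≡ 1 % d) where
  open PosetNotions (_≤NC_ {d} {n})

  gaps-of : (X : NC d n) → GapsOneMod d (proj₁ X)
  gaps-of (π , nc , σ , σ-dual , blocks , σ-blocks) = GapCharacterization.gaps-one-mod π nc d blocks kreweras-blocks
    where
    open Blocks π using (kreweras; kreweras-unique)
    kreweras-blocks : BlocksOneMod d kreweras
    kreweras-blocks x = trans (cong (_% d) (begin
      blockSize kreweras x    ≡⟨ blockSize≡count kreweras x ⟩
      count (rel kreweras x)  ≡⟨ count-cong (λ j → subst T (sym (kreweras-unique nc σ σ-dual x j)))
                                            (λ j → subst T (kreweras-unique nc σ σ-dual x j)) ⟩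
      count (rel σ x)         ≡⟨ blockSize≡count σ x ⟨
      blockSize σ x           ∎)) (σ-blocks x)
      where open ≡-Reasoning

  toNC : (τ : Partition n) → Noncrossing τ → BlocksOneMod d τ → GapsOneMod d τ → NC d n
  toNC τ nc blocks gaps = τ , nc , Blocks.kreweras τ , Blocks.kreweras-isDual τ nc , blocks ,
                          GapCharacterization.kreweras-blocks-one-mod τ nc d blocks n≋1 gaps

  cover⇒numBlocks : ∀ X Y → X ⋖ Y → numBlocks (proj₁ X) ≡ numBlocks (proj₁ Y) + d
  cover⇒numBlocks X@(π , π-nc , _ , _ , π-blocks , _) Y@(σ , σ-nc , _ , _ , σ-blocks , _)
                  ((π≤σ , σ≰π) , no-between) = trans (numBlocks-cong π τ π≤τ τ≤π) numBlocks-τ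
    where
    open Intermediate (Refinement.intermediate-exists π σ π-nc σ-nc π≤σ d
                         π-blocks σ-blocks (gaps-of X) (gaps-of Y) σ≰π)
    τ≤π : τ ≤P π
    τ≤π = ≤P-stable τ π λ τ≰π → no-between (toNC τ noncrossing blocks gaps) (π≤τ , τ≰π) (τ≤σ , σ≰τ)

  chain⇒numBlocks : ∀ {x y k} → SatChain x y k → numBlocks (proj₁ x) ≡ numBlocks (proj₁ y) + k * d
  chain⇒numBlocks {x} done = sym (+-identityʳ (numBlocks (proj₁ x)))
  chain⇒numBlocks {x} {z} (step {y = y} {k = k} x⋖y chain) = begin
    numBlocks (proj₁ x)                 ≡⟨ cover⇒numBlocks x y x⋖y ⟩
    numBlocks (proj₁ y) + d             ≡⟨ cong (_+ d) (chain⇒numBlocks chain) ⟩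
    numBlocks (proj₁ z) + k * d + d     ≡⟨ +-assoc (numBlocks (proj₁ z)) (k * d) d ⟩
    numBlocks (proj₁ z) + (k * d + d)   ≡⟨ cong (numBlocks (proj₁ z) +_) (+-comm (k * d) d) ⟩
    numBlocks (proj₁ z) + suc k * d     ∎
    where open ≡-Reasoning

  bottom : NC d n
  bottom = toNC discrete noncrossing singletons no-gaps
    where
    noncrossing : Noncrossing (discrete {n})
    noncrossing a b c e a<b b<c _ a~c _ = ⊥-elim (<-irrefl (discrete⇒≡ a~c) (<-trans a<b b<c))
    singletons : BlocksOneMod d (discrete {n})
    singletons i = cong (_% d) (trans (blockSize≡count discrete i)
                     (count-single i (rel-refl discrete i) λ j i~j → toℕ-injective (sym (discrete⇒≡ i~j))))
    no-gaps : GapsOneMod d (discrete {n})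
    no-gaps gap = ⊥-elim (<-irrefl (discrete⇒≡ (Consecutive.right∈ gap)) (Consecutive.ordered gap))

  top : NC d n
  top = toNC full (λ _ _ _ _ _ _ _ _ _ → tt) one-block unit-gaps
    where
    one-block : BlocksOneMod d (full {n})
    one-block i = trans (cong (_% d) (trans (blockSize≡count full i) count-all)) n≋1
    unit-gaps : GapsOneMod d (full {n})
    unit-gaps {b} {b′} gap with suc (toℕ b) <? toℕ b′
    ... | yes 1+b<b′ = ⊥-elim (between∉ next (≤-reflexive (sym next≡1+b)) (subst (_< toℕ b′) (sym next≡1+b) 1+b<b′) tt)
      where
      open Consecutive gap
      next = fromℕ< (<-trans 1+b<b′ (toℕ<n b′))
      next≡1+b = toℕ-fromℕ< (<-trans 1+b<b′ (toℕ<n b′))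
    ... | no  1+b≮b′ = cong (_% d) (trans (cong (_∸ toℕ b) (≤-antisym (≮⇒≥ 1+b≮b′) (Consecutive.ordered gap)))
                                          (m+n∸n≡m 1 (toℕ b)))

  minimal⇒numBlocks : ∀ x → Minimal x → numBlocks (proj₁ x) ≡ n
  minimal⇒numBlocks x minimal = numBlocks-discrete (proj₁ x)
    (≤P-stable (proj₁ x) discrete λ x≰discrete → minimal bottom (discrete-least (proj₁ x) , x≰discrete))

  maximal⇒numBlocks : ∀ y → Maximal y → n ∸ numBlocks (proj₁ y) ≡ n ∸ 1
  maximal⇒numBlocks y maximal with 0 <? n
  ... | yes 0<n = cong (n ∸_) (numBlocks-full (proj₁ y) full≤y 0<n)
    where
    full≤y : full ≤P proj₁ y
    full≤y = ≤P-stable full (proj₁ y) λ full≰y → maximal top ((λ _ _ _ → tt) , full≰y)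
  ... | no  0≮n = trans (cong (_∸ numBlocks (proj₁ y)) n≡0)
                        (trans (0∸n≡0 (numBlocks (proj₁ y))) (sym (cong (_∸ 1) n≡0)))
    where
    n≡0 : n ≡ 0
    n≡0 = n≤0⇒n≡0 (≮⇒≥ 0≮n)

  rank-function : HasRankFunction (λ y → (n ∸ numBlocks (proj₁ y)) / d)
  rank-function x y k minimal chain = sym (begin
    (n ∸ numBlocks (proj₁ y)) / d                            ≡⟨ cong (λ m → (m ∸ numBlocks (proj₁ y)) / d) n≡ ⟩
    (numBlocks (proj₁ y) + k * d ∸ numBlocks (proj₁ y)) / d  ≡⟨ cong (_/ d) (m+n∸m≡n (numBlocks (proj₁ y)) (k * d)) ⟩
    k * d / d                                                ≡⟨ m*n/n≡m k d ⟩
    k                                                        ∎)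
    where
    open ≡-Reasoning
    n≡ : n ≡ numBlocks (proj₁ y) + k * d
    n≡ = trans (sym (minimal⇒numBlocks x minimal)) (chain⇒numBlocks chain)

  graded : GradedOfRank ((n ∸ 1) / d)
  graded x y k minimal maximal chain =
    trans (rank-function x y k minimal chain) (cong (_/ d) (maximal⇒numBlocks y maximal))

lemma3p9 : ∀ (d n : ℕ) .{{_ : NonZero d}} → n % d ≡ 1 % d →
    PosetNotions.GradedOfRank (_≤NC_ {d} {n}) ((n ∸ 1) / d) ×
    PosetNotions.HasRankFunction (_≤NC_ {d} {n}) (λ π → (n ∸ numBlocks (proj₁ π)) / d)
lemma3p9 d n n≋1 = NCPoset.graded d n n≋1 , NCPoset.rank-function d n n≋1
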